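{- Let $k\ge 2$ be an integer and let $r$ be an integer with $2\le r\le 2k+1$; put $\kappa=2k+2-r$. For a real number $P\ge 1$, let $V_k(P)$ denote the number of $\mathbf z=(z_1,\ldots,z_{2k+2})\in\mathbb Z^{2k+2}$ with $|z_i|\le P$ satisfying $\sum_{i=1}^{2k+2}z_i^{2j-1}=0$ $(1\le j\le k)$, and let $L_k(P)$ denote the number of $\mathbf z\in\mathbb Z^{2k+2}$ with $|z_i|\le P$ for which $\{1,\ldots,2k+2\}$ can be partitioned into $k+1$ pairs $\{a,b\}$ each with $z_a+z_b=0$. For an integer $r$-tuple $\mathbf z=(z_1,\ldots,z_r)$, define for $1\le m\le r$ \[ u_{0m}=\Bigl(\prod_{\substack{1\le i\le r\\ i\ne m}}z_i\Bigr)\Bigl(\prod_{j=1}^r(z_m+z_j)\Bigr), \] and let $\Psi_k(P;\mathbf z)$ be the number of integer arrays $(u_{lm})_{1\le l\le\kappa,\,1\le m\le r}$ with $1\le|u_{lm}|\le 2P$ satisfying \[ \prod_{i=0}^{\kappa}u_{i1}=\prod_{i=0}^{\kappa}u_{i2}=\cdots=\prod_{i=0}^{\kappa}u_{ir} \] and \[ u_{i1}-z_1=u_{i2}-z_2=\cdots=u_{ir}-z_r\qquad(1\le i\le\kappa). \] Let $\Psi_k(P)=\max_{\mathbf z}\Psi_k(P;\mathbf z)$, the maximum being over all $\mathbf z\in\mathbb Z^r$ with $1\le|z_i|\le P$ $(1\le i\le r)$ and $z_l^2\ne z_m^2$ $(1\le l<m\le r)$. Then there is a constant $C=C(k,r)$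 such that for all $P\ge 1$, \[ V_k(P)-L_k(P)\le C\bigl(P^{r-1}+P^r\Psi_k(P)\bigr). \] -}

module Defs where

open import Data.Nat as ℕ using (ℕ; zero; suc; _≤_; _<_; _⊔_)
import Data.Nat.Properties as ℕₚ
open import Data.Integer as ℤ using (ℤ; +_; ∣_∣; _≟_)
open import Data.Fin using (Fin; toℕ)
open import Data.Fin.Properties using (all?)
import Data.Fin.Properties as Finₚ
open import Data.List as List using (List; []; _∷_; length; filter; upTo; allFin; foldr)
open import Data.List.Relation.Unary.Any using (Any; any?)
open import Data.Vec as Vec using (Vec; []; _∷_; lookup)
open import Data.Product using (_×_; _,_)
open import Relation.Binary.PropositionalEquality using (_≡_; _≢_)
open import Relation.Nullary using (¬_; Dec; does)
open import Data.Bool using (if_then_else_)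
open import Relation.Nullary.Decidable using (_×-dec_; _→-dec_; ¬?)
open import Relation.Unary using (Pred; Decidable)
import Agda.Primitive

intRange : ℕ → List ℤ
intRange B = List.map (λ i → (+ i) ℤ.- (+ B)) (upTo (suc (B ℕ.+ B)))

allVecs : {A : Set} → (n : ℕ) → List A → List (Vec A n)
allVecs zero    xs = [] ∷ []
allVecs (suc n) xs = List.cartesianProductWith _∷_ xs (allVecs n xs)

count : {A : Set} {P : Pred A Agda.Primitive.lzero} → Decidable P → List A → ℕ
count P? xs = length (filter P? xs)

maxList : List ℕ → ℕ
maxList = foldr _⊔_ 0

sumℤ : {n : ℕ} → Vec ℤ n → ℤ
sumℤ = Vec.foldr _ ℤ._+_ (+ 0)

prodℤ : {n : ℕ} → Vec ℤ n → ℤ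
prodℤ = Vec.foldr _ ℤ._*_ (+ 1)

-- Throughout, M = 2P: |x| ≤ P  ⇔  2|x| ≤ M,
-- and |u| ≤ 2P  ⇔  |u| ≤ M  for integers x, u.

InBox : ℕ → ℤ → Set
InBox M x = 2 ℕ.* ∣ x ∣ ≤ M

inBox? : (M : ℕ) → Decidable (InBox M)
inBox? M x = (2 ℕ.* ∣ x ∣) ℕ.≤? M

AllInBox : {n : ℕ} → ℕ → Vec ℤ n → Set
AllInBox {n} M z = (i : Fin n) → InBox M (lookup z i)

allInBox? : {n : ℕ} → (M : ℕ) → Decidable (AllInBox {n} M)
allInBox? M z = all? (λ i → inBox? M (lookup z i))

-- Σ_i z_i^(2j-1) = 0 for 1 ≤ j ≤ k  (index j' = j-1 ∈ Fin k)
OddPowerSumsVanish : (k : ℕ) {n : ℕ} → Vec ℤ n → Set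
OddPowerSumsVanish k z =
  (j : Fin k) → sumℤ (Vec.map (λ x → x ℤ.^ (2 ℕ.* toℕ j ℕ.+ 1)) z) ≡ + 0

oddPowerSumsVanish? : (k : ℕ) {n : ℕ} → Decidable (OddPowerSumsVanish k {n})
oddPowerSumsVanish? k z =
  all? (λ j → sumℤ (Vec.map (λ x → x ℤ.^ (2 ℕ.* toℕ j ℕ.+ 1)) z) ≟ + 0)

VPred : (k M : ℕ) → Vec ℤ (2 ℕ.* k ℕ.+ 2) → Set
VPred k M z = AllInBox M z × OddPowerSumsVanish k z

V : (k M : ℕ) → ℕ
V k M = count (λ z → allInBox? M z ×-dec oddPowerSumsVanish? k z)
              (allVecs (2 ℕ.* k ℕ.+ 2) (intRange M))

-- σ (given as a table Fin n → Fin n) is a fixed-point-free involution,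
-- i.e. it encodes a partition of {1..n} into pairs {a, σ a},
-- and z_a + z_{σ a} = 0 for every a.
PairsToZero : {n : ℕ} → Vec ℤ n → Vec (Fin n) n → Set
PairsToZero {n} z σ = (a : Fin n) →
  (lookup σ (lookup σ a) ≡ a) × (lookup σ a ≢ a)
  × (lookup z a ℤ.+ lookup z (lookup σ a) ≡ + 0)

pairsToZero? : {n : ℕ} (z : Vec ℤ n) → Decidable (PairsToZero z)
pairsToZero? z σ = all? (λ a →
  (lookup σ (lookup σ a) Finₚ.≟ a) ×-dec (¬? (lookup σ a Finₚ.≟ a))
  ×-dec (lookup z a ℤ.+ lookup z (lookup σ a) ≟ + 0))

Pairable : {n : ℕ} → Vec ℤ n → Set
Pairable {n} z = Any (PairsToZero z) (allVecs n (allFin n))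

pairable? : {n : ℕ} → Decidable (Pairable {n})
pairable? {n} z = any? (pairsToZero? z) (allVecs n (allFin n))

L : (k M : ℕ) → ℕ
L k M = count (λ z → allInBox? M z ×-dec pairable? z)
              (allVecs (2 ℕ.* k ℕ.+ 2) (intRange M))

κ : (k r : ℕ) → ℕ
κ k r = (2 ℕ.* k ℕ.+ 2) ℕ.∸ r

u0 : {r : ℕ} → Vec ℤ r → Fin r → ℤ
u0 {r} z m =
  prodℤ (Vec.tabulate (λ i → if does (i Finₚ.≟ m) then + 1 else lookup z i))
  ℤ.* prodℤ (Vec.map (λ zj → lookup z m ℤ.+ zj) z)

-- an array (u_{lm}), 1 ≤ l ≤ κ, 1 ≤ m ≤ r, stored as κ rows of length r
Array : (κ' r : ℕ) → Set
Array κ' r = Vec (Vec ℤ r) κ'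

entry : {κ' r : ℕ} → Array κ' r → Fin κ' → Fin r → ℤ
entry u l m = lookup (lookup u l) m

colProd : {κ' r : ℕ} → Vec ℤ r → Array κ' r → Fin r → ℤ
colProd z u m = u0 z m ℤ.* prodℤ (Vec.map (λ row → lookup row m) u)

EntryBounds : {κ' r : ℕ} → ℕ → Array κ' r → Set
EntryBounds {κ'} {r} M u = (l : Fin κ') (m : Fin r) →
  (1 ≤ ∣ entry u l m ∣) × (∣ entry u l m ∣ ≤ M)

ColProdsEqual : {κ' r : ℕ} → Vec ℤ r → Array κ' r → Set
ColProdsEqual {κ'} {r} z u = (m m′ : Fin r) → colProd z u m ≡ colProd z u m′

RowDiffsEqual : {κ' r : ℕ} → Vec ℤ r → Array κ' r → Set
RowDiffsEqual {κ'} {r} z u = (i : Fin κ') (m m′ : Fin r) →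
  entry u i m ℤ.- lookup z m ≡ entry u i m′ ℤ.- lookup z m′

PsiPred : {κ' r : ℕ} → ℕ → Vec ℤ r → Array κ' r → Set
PsiPred M z u = EntryBounds M u × ColProdsEqual z u × RowDiffsEqual z u

psiPred? : {κ' r : ℕ} (M : ℕ) (z : Vec ℤ r) → Decidable (PsiPred {κ'} M z)
psiPred? M z u =
  all? (λ l → all? (λ m → (1 ℕ.≤? ∣ entry u l m ∣) ×-dec (∣ entry u l m ∣ ℕ.≤? M)))
  ×-dec all? (λ m → all? (λ m′ → colProd z u m ≟ colProd z u m′))
  ×-dec all? (λ i → all? (λ m → all? (λ m′ →
          entry u i m ℤ.- lookup z m ≟ entry u i m′ ℤ.- lookup z m′)))

PsiZ : (k r M : ℕ) → Vec ℤ r → ℕ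
PsiZ k r M z = count (psiPred? {κ k r} M z) (allVecs (κ k r) (allVecs r (intRange M)))

Admissible : {r : ℕ} → ℕ → Vec ℤ r → Set
Admissible {r} M z =
  ((i : Fin r) → (1 ≤ ∣ lookup z i ∣) × InBox M (lookup z i))
  × ((l m : Fin r) → toℕ l < toℕ m → lookup z l ℤ.^ 2 ≢ lookup z m ℤ.^ 2)

admissible? : {r : ℕ} (M : ℕ) → Decidable (Admissible {r} M)
admissible? M z =
  all? (λ i → (1 ℕ.≤? ∣ lookup z i ∣) ×-dec inBox? M (lookup z i))
  ×-dec all? (λ l → all? (λ m →
          (toℕ l ℕ.<? toℕ m) →-dec ¬? (lookup z l ℤ.^ 2 ≟ lookup z m ℤ.^ 2)))

-- Ψ_k(P) = max over admissible z of Ψ_k(P; z)  (0 if there is none)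
Psi : (k r M : ℕ) → ℕ
Psi k r M = maxList (List.map (PsiZ k r M) (filter (admissible? M) (allVecs r (intRange M))))

module Submission where

-- Let z be counted by V but not by L. Newton's identities turn the vanishing of the odd power
-- sums p₁, p₃, …, p_{2k−1} of z into that of e₁, e₃, …, e_{2k−1}, so that
-- Π_j (y + z_j) − Π_j (y − z_j) = 2 e_{2k+1}(z) y =: c y, and Π_j (y + z_j) = c y whenever y
-- is an entry of z. If c = 0, all odd coefficients of Π_j (y − z_j) vanish, the polynomial is
-- even and z splits into pairs {a, −a}; so c ≠ 0. Pick one nonzero entry from each class of
-- entries with equal squares. If there are at most r − 1 classes, z is read off from a table
-- (0, s, −s) with s ∈ [−P, P]^(r−1): O(P^(r−1)) choices. Otherwise let w be r of the picked
-- entries and t the remaining κ entries of z. The array u_{lm} = w_m + t_l has nonzero entries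
-- bounded by 2P, constant row differences u_{lm} − w_m = t_l, and column products
-- u_{0m} Π_l u_{lm} = (Π_{i≠m} w_i) Π_j (w_m + z_j) = c Π_i w_i, independent of m. So u is
-- counted by Ψ_k(P; w), and z is read off from the table (w, t), t being recovered from u:
-- O(P^r Ψ_k(P)) choices.

open import Defs
open import Agda.Primitive using (lzero)
open import Data.Nat as ℕ using (ℕ; zero; suc; _≤_; _<_; _∸_; z≤n; s≤s)
import Data.Nat.Properties as ℕₚ
import Data.Nat.Tactic.RingSolver as ℕ-Solver
open import Data.Integer as ℤ using (ℤ; +_; -[1+_]; 0ℤ; 1ℤ; ∣_∣; _⊖_)
import Data.Integer.Properties as ℤₚ
open import Data.Integer.Tactic.RingSolver using (solve-∀)
open import Data.Fin using (Fin; zero; suc; toℕ; fromℕ<; punchIn; punchOut)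
import Data.Fin.Properties as Finₚ
open import Data.List as List using (List; []; _∷_; _++_; length; filter; upTo; allFin; concatMap)
import Data.List.Properties as Lₚ
open import Data.List.Membership.Propositional using (_∈_; lose; find)
import Data.List.Membership.Propositional.Properties as ∈ₗ
open import Data.List.Membership.Propositional.Properties
  using ( ∈-filter⁺; ∈-filter⁻; ∈-map⁺; ∈-upTo⁺; ∈-allFin; ∈-++⁺ˡ; ∈-++⁺ʳ; ∈-concatMap⁺
        ; ∈-cartesianProductWith⁺)
open import Data.List.Relation.Unary.Any as Anyₗ using (Any; here; there; any?)
import Data.List.Relation.Unary.Any.Properties as Anyₗₚ
open import Data.List.Relation.Unary.All as All using (All; []; _∷_)
import Data.List.Relation.Unary.All.Properties as Allₚ
open import Data.List.Relation.Unary.AllPairs using (AllPairs; []; _∷_)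
import Data.List.Relation.Unary.AllPairs.Properties as AllPairsₚ
open import Data.List.Relation.Unary.Unique.Propositional using (Unique)
import Data.List.Relation.Unary.Unique.Propositional.Properties as Uniqueₚ
open import Data.List.Relation.Binary.Permutation.Propositional
  using (_↭_; ↭-refl; ↭-sym; ↭-trans; ↭-reflexive; prep; ↭⇒↭ₛ)
import Data.List.Relation.Binary.Permutation.Propositional.Properties as ↭ₚ
open import Data.List.Relation.Binary.Permutation.Setoid.Properties using (foldr-commMonoid)
open import Data.Vec as Vec
  using (Vec; []; _∷_; lookup; removeAt; tabulate; toList; fromList; padRight)
import Data.Vec.Properties as Vecₚ
open import Data.Vec.Membership.Propositional using () renaming (_∈_ to _∈ᵥ_)
open import Data.Vec.Membership.Propositional.Properties
  using (∈-lookup; ∈-toList⁺; ∈-toList⁻; ∈-fromList⁺)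
  renaming (∈-map⁺ to ∈ᵥ-map⁺; ∈-++⁺ˡ to ∈ᵥ-++⁺ˡ; ∈-++⁺ʳ to ∈ᵥ-++⁺ʳ)
open import Data.Vec.Relation.Unary.Any using (here; there; index)
open import Data.Vec.Relation.Unary.Any.Properties using (lookup-index)
import Data.Vec.Relation.Unary.All as VAll
import Data.Vec.Relation.Unary.All.Properties as VAllₚ
open import Data.Product using (Σ; ∃; ∃-syntax; _×_; _,_; proj₁; proj₂)
open import Data.Sum using (_⊎_; inj₁; inj₂; map₂)
open import Data.Bool using (if_then_else_)
open import Function using (_∘_)
open import Relation.Binary using (tri<; tri≈; tri>)
open import Relation.Binary.PropositionalEquality
open import Relation.Nullary using (¬_; Dec; yes; no; does)
open import Relation.Nullary.Decidable using (_×-dec_)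
open import Relation.Nullary.Negation using (contradiction)
open import Relation.Unary using (Pred; Decidable)
open import Relation.Unary.Properties using (_∩?_; ∁?)

private variable
  A B : Set
  m n : ℕ

module _ where
  open import Data.Nat using (_+_; _*_; _^_)

  Unique⇒lookup-injective : {xs : List A} → Unique xs →
    ∀ {i j} → List.lookup xs i ≡ List.lookup xs j → i ≡ j
  Unique⇒lookup-injective (_  ∷ _) {zero}  {zero}  _ = refl
  Unique⇒lookup-injective (x∉ ∷ _) {zero}  {suc j} e = contradiction e (All.lookup x∉ (∈ₗ.∈-lookup j))
  Unique⇒lookup-injective (x∉ ∷ _) {suc i} {zero}  e =
    contradiction (sym e) (All.lookup x∉ (∈ₗ.∈-lookup i))
  Unique⇒lookup-injective (_  ∷ u) {suc i} {suc j} e = cong suc (Unique⇒lookup-injective u e)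

  Unique-⊆⇒length≤ : {xs ys : List A} → Unique xs → (∀ {x} → x ∈ xs → x ∈ ys) →
    length xs ≤ length ys
  Unique-⊆⇒length≤ {xs = xs} {ys} u xs⊆ys = Finₚ.injective⇒≤ {f = position} position-injective
    where
    position : Fin (length xs) → Fin (length ys)
    position i = Anyₗ.index (xs⊆ys (∈ₗ.∈-lookup {xs = xs} i))
    position-injective : ∀ {i j} → position i ≡ position j → i ≡ j
    position-injective {i} {j} e = Unique⇒lookup-injective u (begin
      List.lookup xs i             ≡⟨ Anyₗₚ.lookup-index (xs⊆ys (∈ₗ.∈-lookup {xs = xs} i)) ⟩
      List.lookup ys (position i)  ≡⟨ cong (List.lookup ys) e ⟩
      List.lookup ys (position j)  ≡⟨ Anyₗₚ.lookup-index (xs⊆ys (∈ₗ.∈-lookup {xs = xs} j)) ⟨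
      List.lookup xs j             ∎)
      where open ≡-Reasoning

  module _ {P Q : Pred A lzero} (P? : Decidable P) (Q? : Decidable Q) where

    count-≤-count+count-∖ : ∀ xs → count P? xs ≤ count Q? xs + count (P? ∩? ∁? Q?) xs
    count-≤-count+count-∖ []       = z≤n
    count-≤-count+count-∖ (x ∷ xs) with P? x | Q? x
    ... | yes _ | yes _ = s≤s (count-≤-count+count-∖ xs)
    ... | yes _ | no  _ = ℕₚ.≤-trans (s≤s (count-≤-count+count-∖ xs))
                                     (ℕₚ.≤-reflexive (sym (ℕₚ.+-suc _ _)))
    ... | no  _ | yes _ = ℕₚ.m≤n⇒m≤1+n (count-≤-count+count-∖ xs)
    ... | no  _ | no  _ = count-≤-count+count-∖ xs

    count-≤-count+length : {xs : List A} (ys : List A) → Unique xs →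
      (∀ {x} → x ∈ xs → P x → ¬ Q x → x ∈ ys) → count P? xs ≤ count Q? xs + length ys
    count-≤-count+length {xs} ys u covered = ℕₚ.≤-trans (count-≤-count+count-∖ xs)
      (ℕₚ.+-monoʳ-≤ (count Q? xs) (Unique-⊆⇒length≤ (Uniqueₚ.filter⁺ _ u) λ x∈ →
        let x∈xs , px , ¬qx = ∈-filter⁻ (P? ∩? ∁? Q?) x∈ in covered x∈xs px ¬qx))

  ∈-allVecs : {xs : List A} (v : Vec A n) → (∀ i → lookup v i ∈ xs) → v ∈ allVecs n xs
  ∈-allVecs []      _    = here refl
  ∈-allVecs (x ∷ v) v⊆xs = ∈-cartesianProductWith⁺ _∷_ (v⊆xs zero) (∈-allVecs v (v⊆xs ∘ suc))

  allVecs-unique : (n : ℕ) {xs : List A} → Unique xs → Unique (allVecs n xs)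
  allVecs-unique zero    _ = [] ∷ []
  allVecs-unique (suc n) u =
    Uniqueₚ.cartesianProductWith⁺ _∷_ Vecₚ.∷-injective u (allVecs-unique n u)

  length-cartesianProductWith : {C : Set} (f : A → B → C) (xs : List A) (ys : List B) →
    length (List.cartesianProductWith f xs ys) ≡ length xs * length ys
  length-cartesianProductWith f []       ys = refl
  length-cartesianProductWith f (x ∷ xs) ys = begin
    length (List.map (f x) ys ++ List.cartesianProductWith f xs ys)
      ≡⟨ Lₚ.length-++ (List.map (f x) ys) ⟩
    length (List.map (f x) ys) + length (List.cartesianProductWith f xs ys)
      ≡⟨ cong₂ _+_ (Lₚ.length-map (f x) ys) (length-cartesianProductWith f xs ys) ⟩
    length ys + length xs * length ys ∎
    where open ≡-Reasoning

  length-allVecs : (n : ℕ) (xs : List A) → length (allVecs n xs) ≡ length xs ^ n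
  length-allVecs zero    xs = refl
  length-allVecs (suc n) xs = trans (length-cartesianProductWith _∷_ xs (allVecs n xs))
                                    (cong (length xs *_) (length-allVecs n xs))

  length-concatMap-≤ : (f : A → List B) (xs : List A) {c : ℕ} →
    (∀ {x} → x ∈ xs → length (f x) ≤ c) → length (concatMap f xs) ≤ length xs * c
  length-concatMap-≤ f []       _     = z≤n
  length-concatMap-≤ f (x ∷ xs) bound = ℕₚ.≤-trans (ℕₚ.≤-reflexive (Lₚ.length-++ (f x)))
    (ℕₚ.+-mono-≤ (bound (here refl)) (length-concatMap-≤ f xs (bound ∘ there)))

  maxList-≥ : {xs : List ℕ} {x : ℕ} → x ∈ xs → x ≤ maxList xs
  maxList-≥ {y ∷ xs} (here refl) = ℕₚ.m≤m⊔n y (maxList xs)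
  maxList-≥ {y ∷ xs} (there x∈)  = ℕₚ.≤-trans (maxList-≥ x∈) (ℕₚ.m≤n⊔m y (maxList xs))

  ∈-intRange : {M : ℕ} (x : ℤ) → ∣ x ∣ ≤ M → x ∈ intRange M
  ∈-intRange {M} (+ i) i≤M =
    subst (_∈ intRange M) shifted (∈-map⁺ _ (∈-upTo⁺ (s≤s (ℕₚ.+-monoˡ-≤ M i≤M))))
    where
    shifted : + (i + M) ℤ.- + M ≡ + i
    shifted = begin
      + (i + M) ℤ.- + M  ≡⟨ ℤₚ.[+m]-[+n]≡m⊖n (i + M) M ⟩
      (i + M) ⊖ M        ≡⟨ ℤₚ.⊖-≥ (ℕₚ.m≤n+m M i) ⟩
      + (i + M ∸ M)      ≡⟨ cong +_ (ℕₚ.m+n∸n≡m i M) ⟩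
      + i                ∎
      where open ≡-Reasoning
  ∈-intRange {M} -[1+ i ] i<M = subst (_∈ intRange M) shifted
    (∈-map⁺ _ (∈-upTo⁺ (s≤s (ℕₚ.≤-trans (ℕₚ.m∸n≤m M (suc i)) (ℕₚ.m≤m+n M M)))))
    where
    shifted : + (M ∸ suc i) ℤ.- + M ≡ -[1+ i ]
    shifted = begin
      + (M ∸ suc i) ℤ.- + M    ≡⟨ ℤₚ.[+m]-[+n]≡m⊖n (M ∸ suc i) M ⟩
      (M ∸ suc i) ⊖ M          ≡⟨ ℤₚ.⊖-≤ (ℕₚ.m∸n≤m M (suc i)) ⟩
      ℤ.- + (M ∸ (M ∸ suc i))  ≡⟨ cong (λ n → ℤ.- + n) (ℕₚ.m∸[m∸n]≡n i<M) ⟩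
      -[1+ i ]                 ∎
      where open ≡-Reasoning

  intRange-unique : (M : ℕ) → Unique (intRange M)
  intRange-unique M =
    Uniqueₚ.map⁺ (λ e → ℤₚ.+-injective (+-cancelʳ (ℤ.- + M) _ _ e)) (Uniqueₚ.upTo⁺ _)
    where
    open import Algebra.Properties.AbelianGroup ℤₚ.+-0-abelianGroup
      using () renaming (∙-cancelʳ to +-cancelʳ)

  length-intRange : (M : ℕ) → length (intRange M) ≡ suc (M + M)
  length-intRange M = trans (Lₚ.length-map _ (upTo (suc (M + M)))) (Lₚ.length-upTo _)

  readOff : Vec A m → Vec (Fin m) n → Vec A n
  readOff table π = Vec.map (lookup table) π

  readOffs : (n : ℕ) → Vec A m → List (Vec A n)
  readOffs n table = List.map (readOff table) (allVecs n (allFin _))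

  length-readOffs : (n : ℕ) (table : Vec A m) → length (readOffs n table) ≡ m ^ n
  length-readOffs {m = m} n table = begin
    length (readOffs n table)      ≡⟨ Lₚ.length-map (readOff table) (allVecs n (allFin m)) ⟩
    length (allVecs n (allFin m))  ≡⟨ length-allVecs n (allFin m) ⟩
    length (allFin m) ^ n          ≡⟨ cong (_^ n) (Lₚ.length-tabulate (λ i → i)) ⟩
    m ^ n                          ∎
    where open ≡-Reasoning

  ∈-readOffs : (table : Vec A m) (z : Vec A n) → (∀ i → lookup z i ∈ᵥ table) →
    z ∈ readOffs n table
  ∈-readOffs {m = m} {n = n} table z z⊆table = subst (_∈ readOffs _ table) readOff-positions
    (∈-map⁺ (readOff table) (∈-allVecs positions λ _ → ∈-allFin _))
    where
    positions : Vec (Fin m) n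
    positions = tabulate (index ∘ z⊆table)
    readOff-positions : readOff table positions ≡ z
    readOff-positions = begin
      Vec.map (lookup table) (tabulate (index ∘ z⊆table))
        ≡⟨ Vecₚ.tabulate-∘ (lookup table) (index ∘ z⊆table) ⟨
      tabulate (lookup table ∘ index ∘ z⊆table)
        ≡⟨ Vecₚ.tabulate-cong (sym ∘ lookup-index ∘ z⊆table) ⟩
      tabulate (lookup z)
        ≡⟨ Vecₚ.tabulate∘lookup z ⟩
      z ∎
      where open ≡-Reasoning

toList-surjective : (xs : List A) → length xs ≡ n → ∃ λ (v : Vec A n) → toList v ≡ xs
toList-surjective []       refl = [] , refl
toList-surjective (x ∷ xs) refl =
  let v , v≡xs = toList-surjective xs refl in x ∷ v , cong (x ∷_) v≡xs

∈-padRight⁺ : ∀ {x a} {xs : Vec A m} (m≤n : m ≤ n) → x ∈ᵥ xs → x ∈ᵥ padRight m≤n a xs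
∈-padRight⁺ (s≤s _)   (here x≡)  = here x≡
∈-padRight⁺ (s≤s m≤n) (there x∈) = there (∈-padRight⁺ m≤n x∈)

padRight⁺ : ∀ {P : A → Set} {a} {xs : Vec A m} (m≤n : m ≤ n) → P a →
  VAll.All P xs → VAll.All P (padRight m≤n a xs)
padRight⁺ {P = P} {a} z≤n       pa VAll.[]        = replicate⁺ _
  where
  replicate⁺ : ∀ n → VAll.All P (Vec.replicate n a)
  replicate⁺ zero    = VAll.[]
  replicate⁺ (suc n) = pa VAll.∷ replicate⁺ n
padRight⁺             (s≤s m≤n) pa (px VAll.∷ pxs) = px VAll.∷ padRight⁺ m≤n pa pxs

allPairs-lookup : ∀ {R : A → A → Set} (v : Vec A n) → AllPairs R (toList v) →
  ∀ l m → toℕ l < toℕ m → R (lookup v l) (lookup v m)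
allPairs-lookup (x ∷ v) (x~v ∷ _)   zero    (suc m) _         = All.lookup x~v (∈-toList⁺ (∈-lookup m v))
allPairs-lookup (x ∷ v) (_   ∷ pxs) (suc l) (suc m) (s≤s l<m) = allPairs-lookup v pxs l m l<m

module _ where
  open import Data.Integer using (_+_; _-_; _*_; -_; _^_)

  private variable r κ′ : ℕ

  prodℤ-toList : (v : Vec ℤ n) → prodℤ v ≡ List.foldr _*_ 1ℤ (toList v)
  prodℤ-toList []      = refl
  prodℤ-toList (x ∷ v) = cong (x *_) (prodℤ-toList v)

  prodℤ-map-↭ : (f : ℤ → ℤ) {u : Vec ℤ m} {v : Vec ℤ n} → toList u ↭ toList v →
    prodℤ (Vec.map f u) ≡ prodℤ (Vec.map f v)
  prodℤ-map-↭ f {u} {v} u↭v = begin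
    prodℤ (Vec.map f u)
      ≡⟨ prodℤ-toList (Vec.map f u) ⟩
    List.foldr _*_ 1ℤ (toList (Vec.map f u))
      ≡⟨ foldr-commMonoid (setoid ℤ) ℤₚ.*-1-isCommutativeMonoid (↭⇒↭ₛ mapped) ⟩
    List.foldr _*_ 1ℤ (toList (Vec.map f v))
      ≡⟨ prodℤ-toList (Vec.map f v) ⟨
    prodℤ (Vec.map f v) ∎
    where
    open ≡-Reasoning
    mapped : toList (Vec.map f u) ↭ toList (Vec.map f v)
    mapped = subst₂ _↭_ (sym (Vecₚ.toList-map f u)) (sym (Vecₚ.toList-map f v)) (↭ₚ.map⁺ f u↭v)

  prodℤ-++ : (u : Vec ℤ m) (v : Vec ℤ n) → prodℤ (u Vec.++ v) ≡ prodℤ u * prodℤ v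
  prodℤ-++ []      v = sym (ℤₚ.*-identityˡ (prodℤ v))
  prodℤ-++ (x ∷ u) v = trans (cong (x *_) (prodℤ-++ u v)) (sym (ℤₚ.*-assoc x (prodℤ u) (prodℤ v)))

  prodℤ-zero : {x : ℤ} {v : Vec ℤ n} → x ∈ᵥ v → x ≡ 0ℤ → prodℤ v ≡ 0ℤ
  prodℤ-zero {v = _ ∷ v} (here refl) refl = ℤₚ.*-zeroˡ (prodℤ v)
  prodℤ-zero {v = y ∷ _} (there x∈)  x≡0  = trans (cong (y *_) (prodℤ-zero x∈ x≡0)) (ℤₚ.*-zeroʳ y)

  ∑< : ℕ → (ℕ → ℤ) → ℤ
  ∑< zero    f = 0ℤ
  ∑< (suc i) f = ∑< i f + f i

  ∑<-cong : ∀ i {f g : ℕ → ℤ} → (∀ s → s < i → f s ≡ g s) → ∑< i f ≡ ∑< i g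
  ∑<-cong zero    _   = refl
  ∑<-cong (suc i) f≗g =
    cong₂ _+_ (∑<-cong i λ s s<i → f≗g s (ℕₚ.m<n⇒m<1+n s<i)) (f≗g i ℕₚ.≤-refl)

  ∑<-zero : ∀ i {f : ℕ → ℤ} → (∀ s → s < i → f s ≡ 0ℤ) → ∑< i f ≡ 0ℤ
  ∑<-zero i f≗0 = trans (∑<-cong i f≗0) (zeros i)
    where
    zeros : ∀ i → ∑< i (λ _ → 0ℤ) ≡ 0ℤ
    zeros zero    = refl
    zeros (suc i) = trans (ℤₚ.+-identityʳ _) (zeros i)

  ∑<-+ : ∀ i (f g : ℕ → ℤ) → ∑< i (λ s → f s + g s) ≡ ∑< i f + ∑< i g
  ∑<-+ zero    f g = refl
  ∑<-+ (suc i) f g =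
    trans (cong (_+ (f i + g i)) (∑<-+ i f g)) (interchange (∑< i f) (∑< i g) (f i) (g i))
    where
    interchange : ∀ a b c d → (a + b) + (c + d) ≡ (a + c) + (b + d)
    interchange = solve-∀

  ∑<-- : ∀ i (f g : ℕ → ℤ) → ∑< i (λ s → f s - g s) ≡ ∑< i f - ∑< i g
  ∑<-- zero    f g = refl
  ∑<-- (suc i) f g =
    trans (cong (_+ (f i - g i)) (∑<-- i f g)) (interchange (∑< i f) (∑< i g) (f i) (g i))
    where
    interchange : ∀ a b c d → (a - b) + (c - d) ≡ (a + c) - (b + d)
    interchange = solve-∀

  ∑<-*ˡ : ∀ i c (f : ℕ → ℤ) → ∑< i (λ s → c * f s) ≡ c * ∑< i f
  ∑<-*ˡ zero    c f = sym (ℤₚ.*-zeroʳ c)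
  ∑<-*ˡ (suc i) c f = trans (cong (_+ c * f i) (∑<-*ˡ i c f)) (sym (ℤₚ.*-distribˡ-+ c _ _))

  ∑<-shift : ∀ i (f : ℕ → ℤ) → ∑< (suc i) f ≡ f 0 + ∑< i (λ s → f (suc s))
  ∑<-shift zero    f = ℤₚ.+-comm 0ℤ (f 0)
  ∑<-shift (suc i) f = trans (cong (_+ f (suc i)) (∑<-shift i f)) (ℤₚ.+-assoc (f 0) _ _)

  ∑<-telescope : ∀ i (h : ℕ → ℤ) → ∑< i (λ s → h (suc s) - h s) ≡ h i - h 0
  ∑<-telescope zero    h = sym (ℤₚ.+-inverseʳ (h 0))
  ∑<-telescope (suc i) h =
    trans (cong (_+ (h (suc i) - h i)) (∑<-telescope i h)) (collapse (h 0) (h i) (h (suc i)))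
    where
    collapse : ∀ a b c → (b - a) + (c - b) ≡ c - a
    collapse = solve-∀

  ∑<-pairs : ∀ m (f : ℕ → ℤ) →
    ∑< (m ℕ.+ m) f ≡ ∑< m (λ q → f (q ℕ.+ q) + f (suc (q ℕ.+ q)))
  ∑<-pairs zero    f = refl
  ∑<-pairs (suc m) f rewrite ℕₚ.+-suc m m =
    trans (ℤₚ.+-assoc (∑< (m ℕ.+ m) f) (f (m ℕ.+ m)) (f (suc (m ℕ.+ m))))
          (cong (_+ (f (m ℕ.+ m) + f (suc (m ℕ.+ m)))) (∑<-pairs m f))

  -- esym i v = (−1)ⁱ eᵢ(v) is the coefficient of y ^ (n ∸ i) in charPoly v y.
  esym : ℕ → Vec ℤ n → ℤ
  esym zero    _       = 1ℤ
  esym (suc i) []      = 0ℤ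
  esym (suc i) (x ∷ v) = esym (suc i) v - x * esym i v

  esym₋₁ : ℕ → Vec ℤ n → ℤ
  esym₋₁ zero    _ = 0ℤ
  esym₋₁ (suc i) v = esym i v

  esym-∷ : ∀ i x (v : Vec ℤ n) → esym i (x ∷ v) ≡ esym i v - x * esym₋₁ i v
  esym-∷ zero    x v = unit x
    where
    unit : ∀ x → 1ℤ ≡ 1ℤ - x * 0ℤ
    unit = solve-∀
  esym-∷ (suc i) x v = refl

  0-x*0≡0 : ∀ x → 0ℤ - x * 0ℤ ≡ 0ℤ
  0-x*0≡0 = solve-∀

  esym-vanish : ∀ i (v : Vec ℤ n) → n < i → esym i v ≡ 0ℤ
  esym-vanish (suc i) []      _         = refl
  esym-vanish (suc i) (x ∷ v) (s≤s n<i)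
    rewrite esym-vanish (suc i) v (ℕₚ.m<n⇒m<1+n n<i) | esym-vanish i v n<i = 0-x*0≡0 x

  charPoly : Vec ℤ n → ℤ → ℤ
  charPoly v y = prodℤ (Vec.map (λ x → y - x) v)

  esym-constant : (v : Vec ℤ n) → esym n v ≡ charPoly v 0ℤ
  esym-constant []              = refl
  esym-constant {suc n} (x ∷ v)
    rewrite esym-vanish (suc n) v ℕₚ.≤-refl | esym-constant v = factor x (charPoly v 0ℤ)
    where
    factor : ∀ x c → 0ℤ - x * c ≡ (0ℤ - x) * c
    factor = solve-∀

  powerSum : ℕ → Vec ℤ n → ℤ
  powerSum t v = sumℤ (Vec.map (_^ t) v)

  newton : ∀ i (v : Vec ℤ n) → ∑< i (λ s → esym s v * powerSum (i ∸ s) v) + + i * esym i v ≡ 0ℤ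
  newton zero    v       = refl
  newton (suc j) []      =
    cong₂ _+_ (∑<-zero (suc j) λ s _ → ℤₚ.*-zeroʳ (esym s [])) (ℤₚ.*-zeroʳ (+ suc j))
  newton (suc j) (x ∷ v) = begin
    ∑< i (λ s → esym s (x ∷ v) * powerSum (i ∸ s) (x ∷ v)) + + i * esym i (x ∷ v)
      ≡⟨ cong (_+ + i * esym i (x ∷ v)) (∑<-cong i split) ⟩
    ∑< i term + + i * (E i - x * E j)
      ≡⟨ cong (_+ + i * (E i - x * E j)) sums ⟩
    ((S i - x * (0ℤ * P i + S j)) + (E j * x ^ (suc i ∸ i) - 0ℤ * x ^ suc i)) + + i * (E i - x * E j)
      ≡⟨ cong (λ e → ((S i - x * (0ℤ * P i + S j)) + (E j * x ^ e - 0ℤ * x ^ suc i))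
                     + + i * (E i - x * E j))
              (ℕₚ.m+n∸n≡m 1 i) ⟩
    ((S i - x * (0ℤ * P i + S j)) + (E j * (x * 1ℤ) - 0ℤ * x ^ suc i)) + (1ℤ + + j) * (E i - x * E j)
      ≡⟨ regroup (S i) (S j) (E i) (E j) x (P i) (x ^ suc i) (+ j) ⟩
    (S i + + i * E i) - x * (S j + + j * E j)
      ≡⟨ cong₂ (λ a b → a - x * b) (newton i v) (newton j v) ⟩
    0ℤ - x * 0ℤ
      ≡⟨ 0-x*0≡0 x ⟩
    0ℤ ∎
    where
    open ≡-Reasoning
    i = suc j
    E E₋₁ P S h term : ℕ → ℤ
    E s = esym s v
    E₋₁ s = esym₋₁ s v
    P t = powerSum t v
    S i = ∑< i (λ s → E s * P (i ∸ s))
    h s = E₋₁ s * x ^ (suc i ∸ s)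
    term s = (E s * P (i ∸ s) - x * (E₋₁ s * P (i ∸ s))) + (h (suc s) - h s)
    expand : ∀ e e₋₁ x X p →
      (e - x * e₋₁) * (X + p) ≡ (e * p - x * (e₋₁ * p)) + (e * X - e₋₁ * (x * X))
    expand = solve-∀
    split : ∀ s → s < i → esym s (x ∷ v) * powerSum (i ∸ s) (x ∷ v) ≡ term s
    split s s<i rewrite esym-∷ s x v | ℕₚ.+-∸-assoc 1 (ℕₚ.<⇒≤ s<i) =
      expand (E s) (E₋₁ s) x (x ^ (i ∸ s)) (P (i ∸ s))
    sums : ∑< i term ≡ (S i - x * (0ℤ * P i + S j)) + (E j * x ^ (suc i ∸ i) - 0ℤ * x ^ suc i)
    sums = begin
      ∑< i term
        ≡⟨ ∑<-+ i _ _ ⟩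
      ∑< i (λ s → E s * P (i ∸ s) - x * (E₋₁ s * P (i ∸ s))) + ∑< i (λ s → h (suc s) - h s)
        ≡⟨ cong₂ _+_ (trans (∑<-- i _ _) (cong (λ t → S i - t) (∑<-*ˡ i x _))) (∑<-telescope i h) ⟩
      (S i - x * ∑< i (λ s → E₋₁ s * P (i ∸ s))) + (h i - h 0)
        ≡⟨ cong (λ t → (S i - x * t) + (h i - h 0)) (∑<-shift j _) ⟩
      (S i - x * (0ℤ * P i + S j)) + (E j * x ^ (suc i ∸ i) - 0ℤ * x ^ suc i) ∎
    regroup : ∀ Si Sj Ei Ej x p X j →
      ((Si - x * (0ℤ * p + Sj)) + (Ej * (x * 1ℤ) - 0ℤ * X)) + (1ℤ + j) * (Ei - x * Ej)
      ≡ (Si + (1ℤ + j) * Ei) - x * (Sj + j * Ej)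
    regroup = solve-∀

  OddVanishBelow : ℕ → (ℕ → ℤ) → Set
  OddVanishBelow k f = ∀ q → q < k → f (suc (q ℕ.+ q)) ≡ 0ℤ

  parity : ∀ s → (∃ λ q → s ≡ q ℕ.+ q) ⊎ (∃ λ q → s ≡ suc (q ℕ.+ q))
  parity zero    = inj₁ (0 , refl)
  parity (suc s) with parity s
  ... | inj₁ (q , refl) = inj₂ (q , refl)
  ... | inj₂ (q , refl) = inj₁ (suc q , cong suc (sym (ℕₚ.+-suc q q)))

  half-≤ : ∀ {q m} → q ℕ.+ q ≤ m ℕ.+ m → q ≤ m
  half-≤ le = ℕₚ.≮⇒≥ λ m<q → ℕₚ.<⇒≱ (ℕₚ.+-mono-< m<q m<q) le

  half-< : ∀ {q m} → q ℕ.+ q < m ℕ.+ m → q < m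
  half-< lt = ℕₚ.≰⇒> λ m≤q → ℕₚ.<⇒≱ lt (ℕₚ.+-mono-≤ m≤q m≤q)

  ∸-double : ∀ {m q} → q ≤ m → (m ℕ.+ m) ∸ (q ℕ.+ q) ≡ (m ∸ q) ℕ.+ (m ∸ q)
  ∸-double                 z≤n       = refl
  ∸-double {suc m} {suc q} (s≤s q≤m) rewrite ℕₚ.+-suc m m | ℕₚ.+-suc q q = ∸-double q≤m

  ∸-odd : ∀ {m q} → q < m → ∃ λ d → (m ℕ.+ m) ∸ suc (q ℕ.+ q) ≡ suc (d ℕ.+ d)
  ∸-odd {suc m} {zero}  _         = m , ℕₚ.+-suc m m
  ∸-odd {suc m} {suc q} (s≤s q<m) rewrite ℕₚ.+-suc m m | ℕₚ.+-suc q q = ∸-odd q<m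

  -- In Newton's identity at i = 2q + 1 every term of the sum contains an odd power sum of
  -- index at most i or an odd coefficient of index below i.
  oddPowerSums⇒oddEsym : ∀ k (v : Vec ℤ n) →
    OddVanishBelow k (λ t → powerSum t v) → OddVanishBelow k (λ i → esym i v)
  oddPowerSums⇒oddEsym zero    v _  q ()
  oddPowerSums⇒oddEsym (suc k) v ps q q<1+k with ℕₚ.m<1+n⇒m<n∨m≡n q<1+k
  ... | inj₁ q<k  = oddPowerSums⇒oddEsym k v ps′ q q<k
    where
    ps′ : OddVanishBelow k (λ t → powerSum t v)
    ps′ q′ q′<k = ps q′ (ℕₚ.m<n⇒m<1+n q′<k)
  ... | inj₂ refl = cancel (trans (sym (ℤₚ.+-identityˡ _))
                                 (trans (cong (_+ + i * esym i v) (sym (∑<-zero i term))) (newton i v)))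
    where
    i = suc (k ℕ.+ k)
    lower : OddVanishBelow k (λ i → esym i v)
    lower = oddPowerSums⇒oddEsym k v λ q′ q′<k → ps q′ (ℕₚ.m<n⇒m<1+n q′<k)
    cancel : + i * esym i v ≡ 0ℤ → esym i v ≡ 0ℤ
    cancel e with ℤₚ.i*j≡0⇒i≡0∨j≡0 (+ i) e
    ... | inj₂ e≡0 = e≡0
    term : ∀ s → s < i → esym s v * powerSum (i ∸ s) v ≡ 0ℤ
    term s (s≤s s≤2k) with parity s
    ... | inj₁ (q′ , refl) =
      trans (cong (esym s v *_) (trans (cong (λ t → powerSum t v) gap) (ps (k ∸ q′) (s≤s (ℕₚ.m∸n≤m k q′)))))
            (ℤₚ.*-zeroʳ (esym s v))
      where
      gap : i ∸ (q′ ℕ.+ q′) ≡ suc ((k ∸ q′) ℕ.+ (k ∸ q′))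
      gap = trans (ℕₚ.+-∸-assoc 1 s≤2k) (cong suc (∸-double {k} {q′} (half-≤ {q′} {k} s≤2k)))
    ... | inj₂ (q′ , refl) =
      trans (cong (_* powerSum (i ∸ s) v) (lower q′ (half-< s≤2k))) (ℤₚ.*-zeroˡ (powerSum (i ∸ s) v))

  charPoly-expand : (v : Vec ℤ n) (y : ℤ) → charPoly v y ≡ ∑< (suc n) (λ i → esym i v * y ^ (n ∸ i))
  charPoly-expand []              y = refl
  charPoly-expand {suc m} (x ∷ v) y = sym (begin
    ∑< (suc (suc m)) (λ i → esym i (x ∷ v) * y ^ (suc m ∸ i))
      ≡⟨ ∑<-cong (suc (suc m)) (λ i _ → trans (cong (_* Y i) (esym-∷ i x v))
                                               (distrib (E i) (E₋₁ i) x (Y i))) ⟩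
    ∑< (suc (suc m)) (λ i → E i * Y i - x * (E₋₁ i * Y i))
      ≡⟨ trans (∑<-- (suc (suc m)) (λ i → E i * Y i) (λ i → x * (E₋₁ i * Y i)))
               (cong (λ t → ∑< (suc (suc m)) (λ i → E i * Y i) - t)
                     (∑<-*ˡ (suc (suc m)) x (λ i → E₋₁ i * Y i))) ⟩
    ∑< (suc (suc m)) (λ i → E i * Y i) - x * ∑< (suc (suc m)) (λ i → E₋₁ i * Y i)
      ≡⟨ cong₂ (λ a b → a - x * b) leading (∑<-shift (suc m) _) ⟩
    (y * S + 0ℤ * y ^ (m ∸ m)) - x * (0ℤ * y ^ suc m + S)
      ≡⟨ factor y x S (y ^ (m ∸ m)) (y ^ suc m) ⟩
    (y - x) * S
      ≡⟨ cong ((y - x) *_) (charPoly-expand v y) ⟨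
    charPoly (x ∷ v) y ∎)
    where
    open ≡-Reasoning
    E E₋₁ Y : ℕ → ℤ
    E i = esym i v
    E₋₁ i = esym₋₁ i v
    Y i = y ^ (suc m ∸ i)
    S = ∑< (suc m) (λ i → E i * y ^ (m ∸ i))
    distrib : ∀ e e₋₁ x Y → (e - x * e₋₁) * Y ≡ e * Y - x * (e₋₁ * Y)
    distrib = solve-∀
    factor : ∀ y x S Y Z → (y * S + 0ℤ * Y) - x * (0ℤ * Z + S) ≡ (y - x) * S
    factor = solve-∀
    raise : ∀ i → i < suc m → E i * Y i ≡ y * (E i * y ^ (m ∸ i))
    raise i (s≤s i≤m) rewrite ℕₚ.+-∸-assoc 1 i≤m = commute (E i) y (y ^ (m ∸ i))
      where
      commute : ∀ e y Y → e * (y * Y) ≡ y * (e * Y)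
      commute = solve-∀
    leading : ∑< (suc (suc m)) (λ i → E i * Y i) ≡ y * S + 0ℤ * y ^ (m ∸ m)
    leading = cong₂ _+_ (trans (∑<-cong (suc m) raise) (∑<-*ˡ (suc m) y _))
                        (cong (_* y ^ (m ∸ m)) (esym-vanish (suc m) v ℕₚ.≤-refl))

  neg-^-even : ∀ y q → (- y) ^ (q ℕ.+ q) ≡ y ^ (q ℕ.+ q)
  neg-^-even y zero    = refl
  neg-^-even y (suc q) rewrite ℕₚ.+-suc q q | neg-^-even y q = square y (y ^ (q ℕ.+ q))
    where
    square : ∀ y Y → (- y) * ((- y) * Y) ≡ y * (y * Y)
    square = solve-∀

  neg-^-odd : ∀ y q → (- y) ^ suc (q ℕ.+ q) ≡ - (y ^ suc (q ℕ.+ q))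
  neg-^-odd y q rewrite neg-^-even y q = sym (ℤₚ.neg-distribˡ-* y (y ^ (q ℕ.+ q)))

  charPoly-oddPart : ∀ m (v : Vec ℤ (m ℕ.+ m)) y → charPoly v y - charPoly v (- y)
    ≡ ∑< m (λ q → + 2 * esym (suc (q ℕ.+ q)) v * y ^ ((m ℕ.+ m) ∸ suc (q ℕ.+ q)))
  charPoly-oddPart m v y = begin
    charPoly v y - charPoly v (- y)
      ≡⟨ cong₂ _-_ (charPoly-expand v y) (charPoly-expand v (- y)) ⟩
    ∑< (suc len) (λ i → E i * y ^ (len ∸ i)) - ∑< (suc len) (λ i → E i * (- y) ^ (len ∸ i))
      ≡⟨ ∑<-- (suc len) _ _ ⟨
    ∑< len g + g len
      ≡⟨ cong₂ _+_ (∑<-pairs m g) top ⟩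
    ∑< m (λ q → g (q ℕ.+ q) + g (suc (q ℕ.+ q))) + 0ℤ
      ≡⟨ trans (ℤₚ.+-identityʳ _) (∑<-cong m pair) ⟩
    ∑< m (λ q → + 2 * E (suc (q ℕ.+ q)) * y ^ (len ∸ suc (q ℕ.+ q))) ∎
    where
    open ≡-Reasoning
    len = m ℕ.+ m
    E g : ℕ → ℤ
    E i = esym i v
    g i = E i * y ^ (len ∸ i) - E i * (- y) ^ (len ∸ i)
    top : g len ≡ 0ℤ
    top rewrite ℕₚ.n∸n≡0 len = ℤₚ.+-inverseʳ (E len * 1ℤ)
    reflect-even : ∀ {e} d → e ≡ d ℕ.+ d → (- y) ^ e ≡ y ^ e
    reflect-even d refl = neg-^-even y d
    reflect-odd : ∀ {e} d → e ≡ suc (d ℕ.+ d) → (- y) ^ e ≡ - (y ^ e)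
    reflect-odd d refl = neg-^-odd y d
    doubled : ∀ e′ e Y Z → (e′ * Z - e′ * Z) + (e * Y - e * (- Y)) ≡ + 2 * e * Y
    doubled = solve-∀
    pair : ∀ q → q < m →
      g (q ℕ.+ q) + g (suc (q ℕ.+ q)) ≡ + 2 * E (suc (q ℕ.+ q)) * y ^ (len ∸ suc (q ℕ.+ q))
    pair q q<m =
      let d , odd = ∸-odd q<m
          Y = y ^ (len ∸ suc (q ℕ.+ q))
          Z = y ^ (len ∸ (q ℕ.+ q))
      in begin
      g (q ℕ.+ q) + g (suc (q ℕ.+ q))
        ≡⟨ cong₂ (λ a b → (E (q ℕ.+ q) * Z - E (q ℕ.+ q) * a)
                          + (E (suc (q ℕ.+ q)) * Y - E (suc (q ℕ.+ q)) * b))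
                 (reflect-even (m ∸ q) (∸-double (ℕₚ.<⇒≤ q<m))) (reflect-odd d odd) ⟩
      (E (q ℕ.+ q) * Z - E (q ℕ.+ q) * Z) + (E (suc (q ℕ.+ q)) * Y - E (suc (q ℕ.+ q)) * (- Y))
        ≡⟨ doubled (E (q ℕ.+ q)) (E (suc (q ℕ.+ q))) Y Z ⟩
      + 2 * E (suc (q ℕ.+ q)) * Y ∎

  charPoly-oddPart-linear : ∀ k (v : Vec ℤ n) → n ≡ suc k ℕ.+ suc k →
    OddVanishBelow k (λ i → esym i v) →
    ∀ y → charPoly v y - charPoly v (- y) ≡ + 2 * esym (suc (k ℕ.+ k)) v * y
  charPoly-oddPart-linear k v refl odd y = begin
    charPoly v y - charPoly v (- y)
      ≡⟨ charPoly-oddPart (suc k) v y ⟩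
    ∑< k term + term k
      ≡⟨ cong₂ _+_ (∑<-zero k lower) (cong (λ e → + 2 * E * y ^ e) exponent) ⟩
    0ℤ + + 2 * E * (y * 1ℤ)
      ≡⟨ tidy (+ 2 * E) y ⟩
    + 2 * E * y ∎
    where
    open ≡-Reasoning
    E = esym (suc (k ℕ.+ k)) v
    term : ℕ → ℤ
    term q = + 2 * esym (suc (q ℕ.+ q)) v * y ^ ((suc k ℕ.+ suc k) ∸ suc (q ℕ.+ q))
    lower : ∀ q → q < k → term q ≡ 0ℤ
    lower q q<k rewrite odd q q<k = ℤₚ.*-zeroˡ (y ^ ((suc k ℕ.+ suc k) ∸ suc (q ℕ.+ q)))
    exponent : (suc k ℕ.+ suc k) ∸ suc (k ℕ.+ k) ≡ 1
    exponent = trans (cong (_∸ (k ℕ.+ k)) (ℕₚ.+-suc k k)) (ℕₚ.m+n∸n≡m 1 (k ℕ.+ k))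
    tidy : ∀ c y → 0ℤ + c * (y * 1ℤ) ≡ c * y
    tidy = solve-∀

  OddEsymVanish : Vec ℤ n → Set
  OddEsymVanish v = ∀ q → esym (suc (q ℕ.+ q)) v ≡ 0ℤ

  charPoly-even : ∀ m (v : Vec ℤ n) → n ≡ m ℕ.+ m → OddEsymVanish v →
    ∀ y → charPoly v y ≡ charPoly v (- y)
  charPoly-even m v refl odd y = ℤₚ.i-j≡0⇒i≡j _ _ (trans (charPoly-oddPart m v y) (∑<-zero m vanish))
    where
    vanish : ∀ q → q < m → + 2 * esym (suc (q ℕ.+ q)) v * y ^ ((m ℕ.+ m) ∸ suc (q ℕ.+ q)) ≡ 0ℤ
    vanish q _ rewrite odd q = ℤₚ.*-zeroˡ (y ^ ((m ℕ.+ m) ∸ suc (q ℕ.+ q)))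

  charPoly-root : (v : Vec ℤ n) {y : ℤ} → charPoly v y ≡ 0ℤ → ∃ λ j → lookup v j ≡ y
  charPoly-root []      ()
  charPoly-root (x ∷ v) {y} p with ℤₚ.i*j≡0⇒i≡0∨j≡0 (y - x) p
  ... | inj₁ y-x≡0 = zero , sym (ℤₚ.i-j≡0⇒i≡j y x y-x≡0)
  ... | inj₂ root  = let j , vj≡y = charPoly-root v root in suc j , vj≡y

  -- For y ≢ 0, evenness gives 0 = charPoly (y ∷ rest) y = charPoly (y ∷ rest) (−y)
  -- = (−2y) · charPoly rest (−y). For y = 0, the constant coefficient of charPoly rest has the
  -- odd index length rest.
  negationInTail : ∀ m y (rest : Vec ℤ n) → n ≡ suc (m ℕ.+ m) → OddEsymVanish (y ∷ rest) →
    ∃ λ j → lookup rest j ≡ - y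
  negationInTail m y rest refl odd = charPoly-root rest (root (y ℤₚ.≟ 0ℤ))
    where
    vanishes : charPoly (y ∷ rest) (- y) ≡ 0ℤ
    vanishes = trans (sym (charPoly-even (suc m) (y ∷ rest) (cong suc (sym (ℕₚ.+-suc m m))) odd y))
                     (trans (cong (_* charPoly rest y) (ℤₚ.+-inverseʳ y)) (ℤₚ.*-zeroˡ (charPoly rest y)))
    twice : ∀ y → + 2 * y ≡ - (- y - y)
    twice = solve-∀
    drop-zero : ∀ e e′ → e - 0ℤ * e′ ≡ e
    drop-zero = solve-∀
    root : Dec (y ≡ 0ℤ) → charPoly rest (- y) ≡ 0ℤ
    root (yes refl) = begin
      charPoly rest 0ℤ                                      ≡⟨ esym-constant rest ⟨
      esym (suc (m ℕ.+ m)) rest                             ≡⟨ drop-zero _ (esym (m ℕ.+ m) rest) ⟨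
      esym (suc (m ℕ.+ m)) rest - 0ℤ * esym (m ℕ.+ m) rest  ≡⟨ odd m ⟩
      0ℤ                                                    ∎
      where open ≡-Reasoning
    root (no y≢0) with ℤₚ.i*j≡0⇒i≡0∨j≡0 (- y - y) vanishes
    ... | inj₂ root′  = root′
    ... | inj₁ -y-y≡0 with ℤₚ.i*j≡0⇒i≡0∨j≡0 (+ 2) (trans (twice y) (cong -_ -y-y≡0))
    ...   | inj₂ y≡0 = contradiction y≡0 y≢0

  esym-swap : ∀ i a b (w : Vec ℤ n) → esym i (a ∷ b ∷ w) ≡ esym i (b ∷ a ∷ w)
  esym-swap zero          a b w = refl
  esym-swap (suc zero)    a b w = swap₁ (esym 1 w) a b
    where
    swap₁ : ∀ e a b → (e - b * 1ℤ) - a * 1ℤ ≡ (e - a * 1ℤ) - b * 1ℤ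
    swap₁ = solve-∀
  esym-swap (suc (suc i)) a b w = swap₂ (esym (suc (suc i)) w) (esym (suc i) w) (esym i w) a b
    where
    swap₂ : ∀ e₂ e₁ e₀ a b → (e₂ - b * e₁) - a * (e₁ - b * e₀) ≡ (e₂ - a * e₁) - b * (e₁ - a * e₀)
    swap₂ = solve-∀

  esym-cong-∷ : ∀ x {u w : Vec ℤ n} → (∀ i → esym i u ≡ esym i w) →
    ∀ i → esym i (x ∷ u) ≡ esym i (x ∷ w)
  esym-cong-∷ x u≈w zero    = refl
  esym-cong-∷ x u≈w (suc i) = cong₂ (λ a b → a - x * b) (u≈w (suc i)) (u≈w i)

  esym-removeAt : ∀ (v : Vec ℤ (suc n)) j i → esym i v ≡ esym i (lookup v j ∷ removeAt v j)
  esym-removeAt (x ∷ v)     zero    i = refl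
  esym-removeAt (x ∷ y ∷ v) (suc j) i = trans (esym-cong-∷ x (esym-removeAt (y ∷ v) j) i)
                                              (esym-swap i x (lookup (y ∷ v) j) (removeAt (y ∷ v) j))

  esym-pair : ∀ i y (w : Vec ℤ n) →
    esym (suc (suc i)) (y ∷ - y ∷ w) ≡ esym (suc (suc i)) w - y * y * esym i w
  esym-pair zero    y w = pair₀ (esym 2 w) (esym 1 w) y
    where
    pair₀ : ∀ e₂ e₁ y → (e₂ - (- y) * e₁) - y * (e₁ - (- y) * 1ℤ) ≡ e₂ - y * y * 1ℤ
    pair₀ = solve-∀
  esym-pair (suc i) y w = pair₁ (esym (3 ℕ.+ i) w) (esym (2 ℕ.+ i) w) (esym (suc i) w) y
    where
    pair₁ : ∀ e₂ e₁ e₀ y → (e₂ - (- y) * e₁) - y * (e₁ - (- y) * e₀) ≡ e₂ - y * y * e₀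
    pair₁ = solve-∀

  oddEsymVanish-removePair : ∀ y (rest : Vec ℤ (suc n)) j → lookup rest j ≡ - y →
    OddEsymVanish (y ∷ rest) → OddEsymVanish (removeAt rest j)
  oddEsymVanish-removePair y rest j rest-j odd = go
    where
    w = removeAt rest j
    paired : ∀ i → esym i (y ∷ rest) ≡ esym i (y ∷ - y ∷ w)
    paired = esym-cong-∷ y λ i → trans (esym-removeAt rest j i) (cong (λ t → esym i (t ∷ w)) rest-j)
    go : OddEsymVanish w
    go zero    = trans (first (esym 1 w) y) (trans (sym (paired 1)) (odd 0))
      where
      first : ∀ e y → e ≡ (e - (- y) * 1ℤ) - y * 1ℤ
      first = solve-∀
    go (suc q) rewrite ℕₚ.+-suc q q = begin
      esym (3 ℕ.+ (q ℕ.+ q)) w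
        ≡⟨ shift (esym (3 ℕ.+ (q ℕ.+ q)) w) y (esym (suc (q ℕ.+ q)) w) ⟩
      (esym (3 ℕ.+ (q ℕ.+ q)) w - y * y * esym (suc (q ℕ.+ q)) w) + y * y * esym (suc (q ℕ.+ q)) w
        ≡⟨ cong₂ (λ a b → a + y * y * b) (sym (esym-pair (suc (q ℕ.+ q)) y w)) (go q) ⟩
      esym (3 ℕ.+ (q ℕ.+ q)) (y ∷ - y ∷ w) + y * y * 0ℤ
        ≡⟨ cong (λ a → a + y * y * 0ℤ) (trans (sym (paired (3 ℕ.+ (q ℕ.+ q)))) odd′) ⟩
      0ℤ + y * y * 0ℤ
        ≡⟨ annihilate y ⟩
      0ℤ ∎
      where
      open ≡-Reasoning
      odd′ : esym (3 ℕ.+ (q ℕ.+ q)) (y ∷ rest) ≡ 0ℤ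
      odd′ = subst (λ t → esym (suc t) (y ∷ rest) ≡ 0ℤ) (ℕₚ.+-suc (suc q) q) (odd (suc q))
      shift : ∀ a y b → a ≡ (a - y * y * b) + y * y * b
      shift = solve-∀
      annihilate : ∀ y → 0ℤ + y * y * 0ℤ ≡ 0ℤ
      annihilate = solve-∀

  NegPairing : Vec ℤ n → Set
  NegPairing {n} v = Σ (Fin n → Fin n) λ σ →
    ∀ a → σ (σ a) ≡ a × σ a ≢ a × lookup v a + lookup v (σ a) ≡ 0ℤ

  negPairing-extend : ∀ y (rest : Vec ℤ (suc n)) j → lookup rest j ≡ - y →
    NegPairing (removeAt rest j) → NegPairing (y ∷ rest)
  negPairing-extend {n} y rest j rest-j (σ′ , σ′-pairs) = σ , σ-pairs
    where
    σ : Fin (2 ℕ.+ n) → Fin (2 ℕ.+ n)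
    σ zero    = suc j
    σ (suc a) with j Finₚ.≟ a
    ... | yes _   = zero
    ... | no  j≢a = suc (punchIn j (σ′ (punchOut j≢a)))
    σ-partner : σ (suc j) ≡ zero
    σ-partner with j Finₚ.≟ j
    ... | yes _   = refl
    ... | no  j≢j = contradiction refl j≢j
    σ-punchIn : ∀ c → σ (suc (punchIn j c)) ≡ suc (punchIn j (σ′ c))
    σ-punchIn c with j Finₚ.≟ punchIn j c
    ... | yes j≡ = contradiction (sym j≡) (Finₚ.punchInᵢ≢i j c)
    ... | no  j≢ = cong (λ t → suc (punchIn j (σ′ t)))
                        (trans (Finₚ.punchOut-cong j refl) (Finₚ.punchOut-punchIn j))
    lookup-removeAt : ∀ c → lookup (removeAt rest j) c ≡ lookup rest (punchIn j c)
    lookup-removeAt c = trans (cong (lookup (removeAt rest j)) (sym (Finₚ.punchOut-punchIn j)))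
                              (Vecₚ.removeAt-punchOut rest (Finₚ.punchInᵢ≢i j c ∘ sym))
    σ-pairs : ∀ a → σ (σ a) ≡ a × σ a ≢ a × lookup (y ∷ rest) a + lookup (y ∷ rest) (σ a) ≡ 0ℤ
    σ-pairs zero = σ-partner , (λ ()) , trans (cong (λ t → y + t) rest-j) (ℤₚ.+-inverseʳ y)
    σ-pairs (suc a) with j Finₚ.≟ a
    ... | yes refl = refl , (λ ()) , trans (cong (_+ y) rest-j) (ℤₚ.+-inverseˡ y)
    ... | no  j≢a  =
      let b = punchOut j≢a
          invol , fixfree , sums = σ′-pairs b
          a≡ = Finₚ.punchIn-punchOut j≢a
      in trans (σ-punchIn (σ′ b)) (cong suc (trans (cong (punchIn j) invol) a≡))
       , (λ e → fixfree (Finₚ.punchIn-injective j _ _ (trans (Finₚ.suc-injective e) (sym a≡))))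
       , trans (cong₂ _+_ (trans (cong (lookup rest) (sym a≡)) (sym (lookup-removeAt b)))
                          (sym (lookup-removeAt (σ′ b))))
               sums

  oddEsymVanish⇒negPairing : ∀ m (v : Vec ℤ n) → n ≡ m ℕ.+ m → OddEsymVanish v → NegPairing v
  oddEsymVanish⇒negPairing         zero    []                   _  _   = (λ ()) , (λ ())
  oddEsymVanish⇒negPairing         (suc m) (y ∷ [])             eq _   =
    contradiction (trans (ℕₚ.suc-injective eq) (ℕₚ.+-suc m m)) ℕₚ.0≢1+n
  oddEsymVanish⇒negPairing {suc n} (suc m) (y ∷ rest@(_ ∷ _)) eq odd =
    let j , rest-j = negationInTail m y rest length-rest odd
    in negPairing-extend y rest j rest-j
         (oddEsymVanish⇒negPairing m (removeAt rest j) (ℕₚ.suc-injective length-rest)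
                                   (oddEsymVanish-removePair y rest j rest-j odd))
    where
    length-rest : n ≡ suc (m ℕ.+ m)
    length-rest = trans (ℕₚ.suc-injective eq) (ℕₚ.+-suc m m)

  negate : Vec ℤ n → Vec ℤ n
  negate = Vec.map (λ x → - x)

  sumℤ-negate : (v : Vec ℤ n) → sumℤ (negate v) ≡ - sumℤ v
  sumℤ-negate []      = refl
  sumℤ-negate (x ∷ v) =
    trans (cong (λ t → - x + t) (sumℤ-negate v)) (sym (ℤₚ.neg-distrib-+ x (sumℤ v)))

  powerSum-negate : ∀ q (v : Vec ℤ n) →
    powerSum (suc (q ℕ.+ q)) (negate v) ≡ - powerSum (suc (q ℕ.+ q)) v
  powerSum-negate q v = begin
    sumℤ (Vec.map (_^ t) (negate v))       ≡⟨ cong sumℤ (Vecₚ.map-∘ _ (λ x → - x) v) ⟨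
    sumℤ (Vec.map (λ x → (- x) ^ t) v)     ≡⟨ cong sumℤ (Vecₚ.map-cong (λ x → neg-^-odd x q) v) ⟩
    sumℤ (Vec.map (λ x → - (x ^ t)) v)     ≡⟨ cong sumℤ (Vecₚ.map-∘ (λ x → - x) (_^ t) v) ⟩
    sumℤ (negate (Vec.map (_^ t) v))       ≡⟨ sumℤ-negate (Vec.map (_^ t) v) ⟩
    - powerSum t v                         ∎
    where
    open ≡-Reasoning
    t = suc (q ℕ.+ q)

  negate-oddPowerSums : ∀ k (z : Vec ℤ n) → OddPowerSumsVanish k z →
    OddVanishBelow k (λ t → powerSum t (negate z))
  negate-oddPowerSums k z vanish q q<k =
    trans (powerSum-negate q z) (cong -_ (trans (cong (λ t → powerSum t z) odd) (vanish j)))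
    where
    j = fromℕ< q<k
    double : ∀ q → suc (q ℕ.+ q) ≡ 2 ℕ.* q ℕ.+ 1
    double = ℕ-Solver.solve-∀
    odd : suc (q ℕ.+ q) ≡ 2 ℕ.* toℕ j ℕ.+ 1
    odd rewrite Finₚ.toℕ-fromℕ< q<k = double q

  charPoly-negate : (z : Vec ℤ n) (y : ℤ) → charPoly (negate z) y ≡ prodℤ (Vec.map (λ x → y + x) z)
  charPoly-negate []      y = refl
  charPoly-negate (x ∷ z) y = cong₂ _*_ (cong (λ t → y + t) (ℤₚ.neg-involutive x)) (charPoly-negate z y)

  2k+2≡[1+k]+[1+k] : ∀ k → 2 ℕ.* k ℕ.+ 2 ≡ suc k ℕ.+ suc k
  2k+2≡[1+k]+[1+k] = ℕ-Solver.solve-∀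

  -- oddCoeff k z = 2 e_{2k+1}(z)
  oddCoeff : ℕ → Vec ℤ n → ℤ
  oddCoeff k z = + 2 * esym (suc (k ℕ.+ k)) (negate z)

  shiftedProduct≡oddCoeff*y : ∀ k (z : Vec ℤ (2 ℕ.* k ℕ.+ 2)) → OddPowerSumsVanish k z →
    ∀ {y} → y ∈ᵥ z → prodℤ (Vec.map (λ x → y + x) z) ≡ oddCoeff k z * y
  shiftedProduct≡oddCoeff*y k z vanish {y} y∈z = begin
    prodℤ (Vec.map (λ x → y + x) z)
      ≡⟨ charPoly-negate z y ⟨
    charPoly (negate z) y
      ≡⟨ split (charPoly (negate z) y) (charPoly (negate z) (- y)) ⟩
    (charPoly (negate z) y - charPoly (negate z) (- y)) + charPoly (negate z) (- y)
      ≡⟨ cong₂ _+_ (charPoly-oddPart-linear k (negate z) (2k+2≡[1+k]+[1+k] k) odd y) root ⟩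
    oddCoeff k z * y + 0ℤ
      ≡⟨ ℤₚ.+-identityʳ _ ⟩
    oddCoeff k z * y ∎
    where
    open ≡-Reasoning
    split : ∀ a b → a ≡ (a - b) + b
    split = solve-∀
    odd : OddVanishBelow k (λ i → esym i (negate z))
    odd = oddPowerSums⇒oddEsym k (negate z) (negate-oddPowerSums k z vanish)
    root : charPoly (negate z) (- y) ≡ 0ℤ
    root = trans (charPoly-negate z (- y)) (prodℤ-zero (∈ᵥ-map⁺ (λ x → - y + x) y∈z) (ℤₚ.+-inverseˡ y))

  negPairing⇒pairable : (z : Vec ℤ n) → NegPairing (negate z) → Pairable z
  negPairing⇒pairable z (σ , σ-pairs) = lose (∈-allVecs (tabulate σ) (λ _ → ∈-allFin _)) pairs
    where
    unnegate : ∀ a b → - a + - b ≡ 0ℤ → a + b ≡ 0ℤ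
    unnegate a b e = trans (negated a b) (cong -_ e)
      where
      negated : ∀ a b → a + b ≡ - (- a + - b)
      negated = solve-∀
    pairs : PairsToZero z (tabulate σ)
    pairs a rewrite Vecₚ.lookup∘tabulate σ a | Vecₚ.lookup∘tabulate σ (σ a) =
      let invol , fixfree , sums = σ-pairs a
      in invol , fixfree , unnegate (lookup z a) (lookup z (σ a))
           (subst₂ (λ x y → x + y ≡ 0ℤ) (Vecₚ.lookup-map a _ z) (Vecₚ.lookup-map (σ a) _ z) sums)

  oddCoeff≡0⇒pairable : ∀ k (z : Vec ℤ (2 ℕ.* k ℕ.+ 2)) → OddPowerSumsVanish k z →
    oddCoeff k z ≡ 0ℤ → Pairable z
  oddCoeff≡0⇒pairable k z vanish c≡0 =
    negPairing⇒pairable z (oddEsymVanish⇒negPairing (suc k) (negate z) (2k+2≡[1+k]+[1+k] k) odd)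
    where
    odd : OddEsymVanish (negate z)
    odd q with ℕₚ.<-cmp q k
    ... | tri< q<k _ _ = oddPowerSums⇒oddEsym k (negate z) (negate-oddPowerSums k z vanish) q q<k
    ... | tri≈ _ refl _ with ℤₚ.i*j≡0⇒i≡0∨j≡0 (+ 2) c≡0
    ...   | inj₂ e≡0 = e≡0
    odd q | tri> _ _ k<q = esym-vanish (suc (q ℕ.+ q)) (negate z)
      (subst (_< suc (q ℕ.+ q)) (sym (2k+2≡[1+k]+[1+k] k)) (s≤s (ℕₚ.+-mono-≤ k<q k<q)))

  ^2-cases : ∀ x y → x ^ 2 ≡ y ^ 2 → x ≡ y ⊎ x ≡ - y
  ^2-cases x y x²≡y² with ℤₚ.i*j≡0⇒i≡0∨j≡0 (x - y) product≡0
    where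
    factor : ∀ x y → (x - y) * (x + y) ≡ x * (x * 1ℤ) - y * (y * 1ℤ)
    factor = solve-∀
    product≡0 : (x - y) * (x + y) ≡ 0ℤ
    product≡0 = trans (factor x y) (trans (cong (_- y ^ 2) x²≡y²) (ℤₚ.+-inverseʳ (y ^ 2)))
  ... | inj₁ x-y≡0 = inj₁ (ℤₚ.i-j≡0⇒i≡j x y x-y≡0)
  ... | inj₂ x+y≡0 = inj₂ (ℤₚ.i-j≡0⇒i≡j x (- y) (trans (cong (λ t → x + t) (ℤₚ.neg-involutive y)) x+y≡0))

  record SquareClasses (xs : List ℤ) : Set where
    field
      reps rest : List ℤ
      split     : xs ↭ reps ++ rest
      nonzero   : All (_≢ 0ℤ) reps
      distinct  : AllPairs (λ x y → x ^ 2 ≢ y ^ 2) reps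
      covers    : ∀ {x} → x ∈ xs → x ≡ 0ℤ ⊎ Any (λ y → x ^ 2 ≡ y ^ 2) reps

  module _ {x : ℤ} {xs : List ℤ} (c : SquareClasses xs) where
    open SquareClasses c

    squareClasses-∷-rest : x ≡ 0ℤ ⊎ Any (λ y → x ^ 2 ≡ y ^ 2) reps → SquareClasses (x ∷ xs)
    squareClasses-∷-rest covered = record
      { reps = reps ; rest = x ∷ rest
      ; split = ↭-trans (prep x split) (↭-sym (↭ₚ.shift x reps rest))
      ; nonzero = nonzero ; distinct = distinct
      ; covers = λ { (here refl) → covered ; (there x∈) → covers x∈ } }

    squareClasses-∷-reps : x ≢ 0ℤ → All (λ y → x ^ 2 ≢ y ^ 2) reps → SquareClasses (x ∷ xs)
    squareClasses-∷-reps x≢0 fresh = record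
      { reps = x ∷ reps ; rest = rest ; split = prep x split
      ; nonzero = x≢0 ∷ nonzero ; distinct = fresh ∷ distinct
      ; covers = λ { (here refl) → inj₂ (here refl) ; (there x∈) → map₂ there (covers x∈) } }

  squareClasses : (xs : List ℤ) → SquareClasses xs
  squareClasses []       = record
    { reps = [] ; rest = [] ; split = ↭-refl ; nonzero = [] ; distinct = [] ; covers = λ () }
  squareClasses (x ∷ xs) with squareClasses xs
  ... | c with x ℤₚ.≟ 0ℤ | any? (λ y → x ^ 2 ℤₚ.≟ y ^ 2) (SquareClasses.reps c)
  ...   | yes x≡0 | _         = squareClasses-∷-rest c (inj₁ x≡0)
  ...   | no  _   | yes x~rep = squareClasses-∷-rest c (inj₂ x~rep)
  ...   | no  x≢0 | no  fresh = squareClasses-∷-reps c x≢0 (Allₚ.¬Any⇒All¬ _ fresh)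

  record SplitOff (r n : ℕ) (xs : List ℤ) : Set where
    field
      w          : Vec ℤ r
      t          : Vec ℤ (n ∸ r)
      ↭w++t      : xs ↭ toList (w Vec.++ t)
      w-nonzero  : ∀ m → lookup w m ≢ 0ℤ
      w-distinct : ∀ l m → toℕ l < toℕ m → lookup w l ^ 2 ≢ lookup w m ^ 2

  splitOff : ∀ r {n xs} (c : SquareClasses xs) → length xs ≡ n →
    r ≤ length (SquareClasses.reps c) → SplitOff r n xs
  splitOff r {n} {xs} c length-xs many = record
    { w = w ; t = t ; ↭w++t = ↭w++t
    ; w-nonzero  = λ m → All.lookup (subst (All (_≢ 0ℤ)) (sym toList-w) (Allₚ.take⁺ r nonzero))
                                    (∈-toList⁺ (∈-lookup m w))
    ; w-distinct = allPairs-lookup w (subst (AllPairs _) (sym toList-w) (AllPairsₚ.take⁺ r distinct))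
    }
    where
    open SquareClasses c
    length-take : length (List.take r reps) ≡ r
    length-take = trans (Lₚ.length-take r reps) (ℕₚ.m≤n⇒m⊓n≡m many)
    length-drop : length (List.drop r reps ++ rest) ≡ n ∸ r
    length-drop = begin
      length (List.drop r reps ++ rest)          ≡⟨ Lₚ.length-++ (List.drop r reps) ⟩
      length (List.drop r reps) ℕ.+ length rest  ≡⟨ cong (ℕ._+ length rest) (Lₚ.length-drop r reps) ⟩
      (length reps ∸ r) ℕ.+ length rest          ≡⟨ ℕₚ.+-∸-comm (length rest) many ⟨
      (length reps ℕ.+ length rest) ∸ r          ≡⟨ cong (_∸ r) (sym (Lₚ.length-++ reps)) ⟩
      length (reps ++ rest) ∸ r                  ≡⟨ cong (_∸ r) (trans (sym (↭ₚ.↭-length split)) length-xs) ⟩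
      n ∸ r                                      ∎
      where open ≡-Reasoning
    w : Vec ℤ r
    w = proj₁ (toList-surjective (List.take r reps) length-take)
    toList-w : toList w ≡ List.take r reps
    toList-w = proj₂ (toList-surjective (List.take r reps) length-take)
    t : Vec ℤ (n ∸ r)
    t = proj₁ (toList-surjective (List.drop r reps ++ rest) length-drop)
    toList-t : toList t ≡ List.drop r reps ++ rest
    toList-t = proj₂ (toList-surjective (List.drop r reps ++ rest) length-drop)
    ↭w++t : xs ↭ toList (w Vec.++ t)
    ↭w++t = ↭-trans split (↭-reflexive (begin
      reps ++ rest                                    ≡⟨ cong (_++ rest) (Lₚ.take++drop≡id r reps) ⟨
      (List.take r reps ++ List.drop r reps) ++ rest  ≡⟨ Lₚ.++-assoc (List.take r reps) _ rest ⟩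
      List.take r reps ++ (List.drop r reps ++ rest)  ≡⟨ cong₂ _++_ toList-w toList-t ⟨
      toList w ++ toList t                            ≡⟨ Vecₚ.toList-++ w t ⟨
      toList (w Vec.++ t)                             ∎))
      where open ≡-Reasoning

  nonzero⇒1≤∣∣ : ∀ {x} → x ≢ 0ℤ → 1 ≤ ∣ x ∣
  nonzero⇒1≤∣∣ x≢0 = ℕₚ.n≢0⇒n>0 (x≢0 ∘ ℤₚ.∣i∣≡0⇒i≡0)

  InBox⇒∣∣≤ : ∀ {M} x → InBox M x → ∣ x ∣ ≤ M
  InBox⇒∣∣≤ x = ℕₚ.≤-trans (ℕₚ.m≤m+n ∣ x ∣ _)

  ∣+∣≤-InBox : ∀ {M} a b → InBox M a → InBox M b → ∣ a + b ∣ ≤ M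
  ∣+∣≤-InBox {M} a b 2a≤M 2b≤M = ℕₚ.≤-trans (ℤₚ.∣i+j∣≤∣i∣+∣j∣ a b)
    (half-≤ (subst (_≤ M ℕ.+ M) (regroup ∣ a ∣ ∣ b ∣) (ℕₚ.+-mono-≤ 2a≤M 2b≤M)))
    where
    regroup : ∀ a b → 2 ℕ.* a ℕ.+ 2 ℕ.* b ≡ (a ℕ.+ b) ℕ.+ (a ℕ.+ b)
    regroup = ℕ-Solver.solve-∀

  sumArray : Vec ℤ r → Vec ℤ κ′ → Array κ′ r
  sumArray w t = Vec.map (λ tₗ → Vec.map (λ wₘ → wₘ + tₗ) w) t

  entry-sumArray : (w : Vec ℤ r) (t : Vec ℤ κ′) (l : Fin κ′) (m : Fin r) →
    entry (sumArray w t) l m ≡ lookup w m + lookup t l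
  entry-sumArray w t l m = trans (cong (λ row → lookup row m) (Vecₚ.lookup-map l _ t))
                                 (Vecₚ.lookup-map m (λ wₘ → wₘ + lookup t l) w)

  column-sumArray : (w : Vec ℤ r) (t : Vec ℤ κ′) (m : Fin r) →
    Vec.map (λ row → lookup row m) (sumArray w t) ≡ Vec.map (λ tₗ → lookup w m + tₗ) t
  column-sumArray w t m = trans (sym (Vecₚ.map-∘ _ _ t)) (Vecₚ.map-cong (λ tₗ → Vecₚ.lookup-map m _ w) t)

  firstColumn-sumArray : (w : Vec ℤ (suc r)) (t : Vec ℤ κ′) →
    Vec.map (λ row → lookup row zero - lookup w zero) (sumArray w t) ≡ t
  firstColumn-sumArray (w₀ ∷ w) t = begin
    Vec.map (λ row → lookup row zero - w₀) (sumArray (w₀ ∷ w) t)  ≡⟨ Vecₚ.map-∘ _ _ t ⟨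
    Vec.map (λ tₗ → (w₀ + tₗ) - w₀) t                            ≡⟨ Vecₚ.map-cong (cancel w₀) t ⟩
    Vec.map (λ tₗ → tₗ) t                                        ≡⟨ Vecₚ.map-id t ⟩
    t                                                            ∎
    where
    open ≡-Reasoning
    cancel : ∀ a b → (a + b) - a ≡ b
    cancel = solve-∀

  sumArray-rowDiffs : (w : Vec ℤ r) (t : Vec ℤ κ′) → RowDiffsEqual w (sumArray w t)
  sumArray-rowDiffs w t l m m′ = begin
    entry (sumArray w t) l m - lookup w m      ≡⟨ cong (_- lookup w m) (entry-sumArray w t l m) ⟩
    (lookup w m + lookup t l) - lookup w m     ≡⟨ cancel (lookup w m) (lookup w m′) (lookup t l) ⟩
    (lookup w m′ + lookup t l) - lookup w m′   ≡⟨ cong (_- lookup w m′) (entry-sumArray w t l m′) ⟨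
    entry (sumArray w t) l m′ - lookup w m′    ∎
    where
    open ≡-Reasoning
    cancel : ∀ a a′ b → (a + b) - a ≡ (a′ + b) - a′
    cancel = solve-∀

  othersProduct : Vec ℤ r → Fin r → ℤ
  othersProduct z m = prodℤ (tabulate (λ i → if does (i Finₚ.≟ m) then + 1 else lookup z i))

  othersProduct-* : (w : Vec ℤ r) (m : Fin r) → othersProduct w m * lookup w m ≡ prodℤ w
  othersProduct-* (x ∷ w) zero    rewrite Vecₚ.tabulate∘lookup w = swap x (prodℤ w)
    where
    swap : ∀ x p → (+ 1 * p) * x ≡ x * p
    swap = solve-∀
  othersProduct-* (x ∷ w) (suc m) = trans (ℤₚ.*-assoc x _ (lookup w m)) (cong (x *_) (othersProduct-* w m))

  module _ (w : Vec ℤ r) (t : Vec ℤ κ′) (c : ℤ)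
           (linear : ∀ m → prodℤ (Vec.map (λ x → lookup w m + x) (w Vec.++ t)) ≡ c * lookup w m) where

    sumArray-colProd : ∀ m → colProd w (sumArray w t) m ≡ c * prodℤ w
    sumArray-colProd m = begin
      colProd w (sumArray w t) m
        ≡⟨ cong (λ col → u0 w m * prodℤ col) (column-sumArray w t m) ⟩
      (othersProduct w m * prodℤ (Vec.map f w)) * prodℤ (Vec.map f t)
        ≡⟨ ℤₚ.*-assoc (othersProduct w m) _ _ ⟩
      othersProduct w m * (prodℤ (Vec.map f w) * prodℤ (Vec.map f t))
        ≡⟨ cong (othersProduct w m *_) (prodℤ-++ (Vec.map f w) (Vec.map f t)) ⟨
      othersProduct w m * prodℤ (Vec.map f w Vec.++ Vec.map f t)
        ≡⟨ cong (λ v → othersProduct w m * prodℤ v) (Vecₚ.map-++ f w t) ⟨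
      othersProduct w m * prodℤ (Vec.map f (w Vec.++ t))
        ≡⟨ cong (othersProduct w m *_) (linear m) ⟩
      othersProduct w m * (c * lookup w m)
        ≡⟨ rearrange (othersProduct w m) c (lookup w m) ⟩
      c * (othersProduct w m * lookup w m)
        ≡⟨ cong (c *_) (othersProduct-* w m) ⟩
      c * prodℤ w ∎
      where
      open ≡-Reasoning
      f = λ x → lookup w m + x
      rearrange : ∀ a c x → a * (c * x) ≡ c * (a * x)
      rearrange = solve-∀

    sumArray-nonzero : c ≢ 0ℤ → (∀ m → lookup w m ≢ 0ℤ) → ∀ l m → entry (sumArray w t) l m ≢ 0ℤ
    sumArray-nonzero c≢0 w≢0 l m entry≡0 with ℤₚ.i*j≡0⇒i≡0∨j≡0 c (trans (sym (linear m)) factor≡0)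
      where
      factor≡0 : prodℤ (Vec.map (λ x → lookup w m + x) (w Vec.++ t)) ≡ 0ℤ
      factor≡0 = prodℤ-zero (∈ᵥ-map⁺ (λ x → lookup w m + x) (∈ᵥ-++⁺ʳ w (∈-lookup l t)))
                            (trans (sym (entry-sumArray w t l m)) entry≡0)
    ... | inj₁ c≡0 = c≢0 c≡0
    ... | inj₂ w≡0 = w≢0 m w≡0

    sumArray-psi : ∀ {M} → c ≢ 0ℤ → (∀ m → lookup w m ≢ 0ℤ) →
      (∀ m → InBox M (lookup w m)) → (∀ l → InBox M (lookup t l)) → PsiPred M w (sumArray w t)
    sumArray-psi {M} c≢0 w≢0 w-boxed t-boxed = bounds , colProds , sumArray-rowDiffs w t
      where
      bounds : EntryBounds M (sumArray w t)
      bounds l m = nonzero⇒1≤∣∣ (sumArray-nonzero c≢0 w≢0 l m)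
                 , subst (λ e → ∣ e ∣ ≤ M) (sym (entry-sumArray w t l m))
                         (∣+∣≤-InBox (lookup w m) (lookup t l) (w-boxed m) (t-boxed l))
      colProds : ColProdsEqual w (sumArray w t)
      colProds m m′ = trans (sumArray-colProd m) (sym (sumArray-colProd m′))

open import Data.Nat using (_+_; _*_; _^_)

-- (2r − 1)^N and (r + κ)^N count the maps from the N positions of z into the two kinds of
-- tables below, and 3^j absorbs (2M + 1)^j ≤ (3M)^j.
constant : (k r′ : ℕ) → ℕ
constant k r′ = 3 ^ r′ * suc (r′ + r′) ^ (2 * k + 2)
              + 3 ^ suc r′ * (suc r′ + κ k (suc r′)) ^ (2 * k + 2)

suc[M+M]^j≤3^j*M^j : ∀ {M} j → 1 ≤ M → suc (M + M) ^ j ≤ 3 ^ j * M ^ j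
suc[M+M]^j≤3^j*M^j zero    _   = ℕₚ.≤-refl
suc[M+M]^j≤3^j*M^j {M} (suc j) 1≤M = begin
  suc (M + M) * suc (M + M) ^ j
    ≤⟨ ℕₚ.*-mono-≤ (ℕₚ.+-monoˡ-≤ (M + M) 1≤M) (suc[M+M]^j≤3^j*M^j j 1≤M) ⟩
  (M + (M + M)) * (3 ^ j * M ^ j)
    ≡⟨ regroup M (3 ^ j) (M ^ j) ⟩
  (3 * 3 ^ j) * (M * M ^ j) ∎
  where
  open ℕₚ.≤-Reasoning
  regroup : ∀ M a b → (M + (M + M)) * (a * b) ≡ (3 * a) * (M * b)
  regroup = ℕ-Solver.solve-∀

+-≤-*-+ : ∀ {x y} p q A B → x ≤ A * p → y ≤ B * q → x + y ≤ (p + q) * (A + B)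
+-≤-*-+ {x} {y} p q A B x≤ y≤ = begin
  x + y                              ≤⟨ ℕₚ.+-mono-≤ x≤ y≤ ⟩
  A * p + B * q                      ≤⟨ ℕₚ.m≤m+n (A * p + B * q) (p * B + q * A) ⟩
  (A * p + B * q) + (p * B + q * A)  ≡⟨ expand p q A B ⟩
  (p + q) * (A + B)                  ∎
  where
  open ℕₚ.≤-Reasoning
  expand : ∀ p q A B → (A * p + B * q) + (p * B + q * A) ≡ (p + q) * (A + B)
  expand = ℕ-Solver.solve-∀

module Candidates (k r′ M : ℕ) where

  r N κ′ : ℕ
  r  = suc r′
  N  = 2 * k + 2
  κ′ = κ k r

  Box : List ℤ
  Box = intRange M

  signTable : Vec ℤ r′ → Vec ℤ (suc (r′ + r′))
  signTable s = 0ℤ ∷ s Vec.++ Vec.map (λ x → ℤ.- x) s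

  psiTable : Vec ℤ r → Array κ′ r → Vec ℤ (r + κ′)
  psiTable w u = w Vec.++ Vec.map (λ row → lookup row zero ℤ.- lookup w zero) u

  admissibles : List (Vec ℤ r)
  admissibles = filter (admissible? M) (allVecs r Box)

  psiArrays : Vec ℤ r → List (Array κ′ r)
  psiArrays w = filter (psiPred? M w) (allVecs κ′ (allVecs r Box))

  signTableVectors psiTableVectors candidates : List (Vec ℤ N)
  signTableVectors = concatMap (λ s → readOffs N (signTable s)) (allVecs r′ Box)
  psiTableVectors  = concatMap (λ w → concatMap (λ u → readOffs N (psiTable w u)) (psiArrays w))
                               admissibles
  candidates       = signTableVectors ++ psiTableVectors

  length-signTableVectors : length signTableVectors ≤ suc (M + M) ^ r′ * suc (r′ + r′) ^ N
  length-signTableVectors = ℕₚ.≤-trans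
    (length-concatMap-≤ _ (allVecs r′ Box) λ {s} _ → ℕₚ.≤-reflexive (length-readOffs N (signTable s)))
    (ℕₚ.≤-reflexive (cong (_* suc (r′ + r′) ^ N)
                          (trans (length-allVecs r′ Box) (cong (_^ r′) (length-intRange M)))))

  length-psiTableVectors : length psiTableVectors ≤ suc (M + M) ^ r * (Psi k r M * (r + κ′) ^ N)
  length-psiTableVectors =
    ℕₚ.≤-trans (length-concatMap-≤ _ admissibles per-w) (ℕₚ.*-monoˡ-≤ _ length-admissibles)
    where
    length-admissibles : length admissibles ≤ suc (M + M) ^ r
    length-admissibles = ℕₚ.≤-trans (Lₚ.length-filter (admissible? M) (allVecs r Box))
      (ℕₚ.≤-reflexive (trans (length-allVecs r Box) (cong (_^ r) (length-intRange M))))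
    per-w : ∀ {w} → w ∈ admissibles →
      length (concatMap (λ u → readOffs N (psiTable w u)) (psiArrays w)) ≤ Psi k r M * (r + κ′) ^ N
    per-w {w} w∈ = ℕₚ.≤-trans
      (length-concatMap-≤ _ (psiArrays w) λ {u} _ → ℕₚ.≤-reflexive (length-readOffs N (psiTable w u)))
      (ℕₚ.*-monoˡ-≤ _ (maxList-≥ (∈-map⁺ (PsiZ k r M) w∈)))

  length-candidates : 1 ≤ M → length candidates ≤ constant k r′ * (M ^ r′ + M ^ r * Psi k r M)
  length-candidates 1≤M = begin
    length candidates
      ≡⟨ Lₚ.length-++ signTableVectors ⟩
    length signTableVectors + length psiTableVectors
      ≤⟨ +-≤-*-+ (3 ^ r′ * suc (r′ + r′) ^ N) (3 ^ r * (r + κ′) ^ N) (M ^ r′) (M ^ r * Psi k r M)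
                 sign-bound psi-bound ⟩
    constant k r′ * (M ^ r′ + M ^ r * Psi k r M) ∎
    where
    open ℕₚ.≤-Reasoning
    sign-bound : length signTableVectors ≤ M ^ r′ * (3 ^ r′ * suc (r′ + r′) ^ N)
    sign-bound = ℕₚ.≤-trans length-signTableVectors
      (ℕₚ.≤-trans (ℕₚ.*-monoˡ-≤ _ (suc[M+M]^j≤3^j*M^j r′ 1≤M))
                   (ℕₚ.≤-reflexive (regroup (3 ^ r′) (M ^ r′) (suc (r′ + r′) ^ N))))
      where
      regroup : ∀ t m a → (t * m) * a ≡ m * (t * a)
      regroup = ℕ-Solver.solve-∀
    psi-bound : length psiTableVectors ≤ M ^ r * Psi k r M * (3 ^ r * (r + κ′) ^ N)
    psi-bound = ℕₚ.≤-trans length-psiTableVectors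
      (ℕₚ.≤-trans (ℕₚ.*-monoˡ-≤ _ (suc[M+M]^j≤3^j*M^j r 1≤M))
                   (ℕₚ.≤-reflexive (regroup (3 ^ r) (M ^ r) (Psi k r M) ((r + κ′) ^ N))))
      where
      regroup : ∀ t m p b → (t * m) * (p * b) ≡ m * p * (t * b)
      regroup = ℕ-Solver.solve-∀

  module _ {z : Vec ℤ N} (box : AllInBox M z) where
    open SquareClasses (squareClasses (toList z))

    boxed : ∀ {x} → x ∈ toList z → InBox M x
    boxed x∈ = VAll.lookup (VAllₚ.lookup⁻ box) (∈-toList⁻ x∈)

    ∈-signTableVectors : length reps ≤ r′ → z ∈ signTableVectors
    ∈-signTableVectors few =
      ∈-concatMap⁺ (λ s → readOffs N (signTable s)) (lose s∈ (∈-readOffs (signTable s) z inTable))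
      where
      s : Vec ℤ r′
      s = padRight few 0ℤ (fromList reps)
      rep∈s : ∀ {y} → y ∈ reps → y ∈ᵥ s
      rep∈s = ∈-padRight⁺ few ∘ ∈-fromList⁺
      s-boxed : VAll.All (InBox M) s
      s-boxed = padRight⁺ few z≤n (VAllₚ.fromList⁺ (All.tabulate λ y∈ →
                  boxed (↭ₚ.∈-resp-↭ (↭-sym split) (∈-++⁺ˡ y∈))))
      s∈ : s ∈ allVecs r′ Box
      s∈ = ∈-allVecs s λ i → ∈-intRange _ (InBox⇒∣∣≤ (lookup s i) (VAllₚ.lookup⁺ s-boxed i))
      inTable : ∀ i → lookup z i ∈ᵥ signTable s
      inTable i with covers (∈-toList⁺ (∈-lookup i z))
      ... | inj₁ x≡0 = here x≡0
      ... | inj₂ x~rep with find x~rep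
      ...   | y , y∈ , x²≡y² with ^2-cases (lookup z i) y x²≡y²
      ...     | inj₁ x≡y  = there (∈ᵥ-++⁺ˡ (subst (_∈ᵥ s) (sym x≡y) (rep∈s y∈)))
      ...     | inj₂ x≡-y = there (∈ᵥ-++⁺ʳ s (subst (_∈ᵥ _) (sym x≡-y) (∈ᵥ-map⁺ (λ x → ℤ.- x) (rep∈s y∈))))

    ∈-psiTableVectors : OddPowerSumsVanish k z → ¬ Pairable z → r ≤ length reps → z ∈ psiTableVectors
    ∈-psiTableVectors vanish unpaired many =
      ∈-concatMap⁺ (λ w → concatMap (λ u → readOffs N (psiTable w u)) (psiArrays w))
        (lose w∈ (∈-concatMap⁺ (λ u → readOffs N (psiTable w u)) (lose u∈ z∈)))
      where
      open SplitOff (splitOff r (squareClasses (toList z)) (Vecₚ.length-toList z) many)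
      inZ : ∀ {x} → x ∈ᵥ w Vec.++ t → x ∈ toList z
      inZ = ↭ₚ.∈-resp-↭ (↭-sym ↭w++t) ∘ ∈-toList⁺
      w-boxed : ∀ m → InBox M (lookup w m)
      w-boxed m = boxed (inZ (∈ᵥ-++⁺ˡ (∈-lookup m w)))
      t-boxed : ∀ l → InBox M (lookup t l)
      t-boxed l = boxed (inZ (∈ᵥ-++⁺ʳ w (∈-lookup l t)))
      c : ℤ
      c = oddCoeff k z
      linear : ∀ m → prodℤ (Vec.map (λ x → lookup w m ℤ.+ x) (w Vec.++ t)) ≡ c ℤ.* lookup w m
      linear m = trans (prodℤ-map-↭ (λ x → lookup w m ℤ.+ x) (↭-sym ↭w++t))
                       (shiftedProduct≡oddCoeff*y k z vanish (∈-toList⁻ (inZ (∈ᵥ-++⁺ˡ (∈-lookup m w)))))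
      u : Array κ′ r
      u = sumArray w t
      psi : PsiPred M w u
      psi = sumArray-psi w t c linear (unpaired ∘ oddCoeff≡0⇒pairable k z vanish) w-nonzero w-boxed t-boxed
      w∈ : w ∈ admissibles
      w∈ = ∈-filter⁺ (admissible? M) (∈-allVecs w λ m → ∈-intRange _ (InBox⇒∣∣≤ (lookup w m) (w-boxed m)))
                     ((λ m → nonzero⇒1≤∣∣ (w-nonzero m) , w-boxed m) , w-distinct)
      u∈ : u ∈ psiArrays w
      u∈ = ∈-filter⁺ (psiPred? M w) (∈-allVecs u λ l → ∈-allVecs (lookup u l) λ m →
                                      ∈-intRange _ (proj₂ (proj₁ psi l m))) psi
      z∈ : z ∈ readOffs N (psiTable w u)
      z∈ = subst (λ table → z ∈ readOffs N table) (sym (cong (w Vec.++_) (firstColumn-sumArray w t)))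
             (∈-readOffs (w Vec.++ t) z λ i → ∈-toList⁻ (↭ₚ.∈-resp-↭ ↭w++t (∈-toList⁺ (∈-lookup i z))))

  V≤L+candidates : V k M ≤ L k M + length candidates
  V≤L+candidates = count-≤-count+length
    (λ z → allInBox? M z ×-dec oddPowerSumsVanish? k z) (λ z → allInBox? M z ×-dec pairable? z)
    candidates (allVecs-unique N (intRange-unique M)) classify
    where
    classify : ∀ {z} → z ∈ allVecs N Box → AllInBox M z × OddPowerSumsVanish k z →
               ¬ (AllInBox M z × Pairable z) → z ∈ candidates
    classify {z} _ (box , vanish) unpaired with length (SquareClasses.reps (squareClasses (toList z))) ℕ.≤? r′
    ... | yes few  = ∈-++⁺ˡ (∈-signTableVectors box few)
    ... | no  many =
      ∈-++⁺ʳ signTableVectors (∈-psiTableVectors box vanish (unpaired ∘ (box ,_)) (ℕₚ.≰⇒> many))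

lemma2p2 : (k r : ℕ) → 2 ≤ k → 2 ≤ r → r ≤ 2 * k + 1 →
    ∃[ C ] ((M : ℕ) → 2 ≤ M →
    V k M ≤ L k M + C * (M ^ (r ∸ 1) + M ^ r * Psi k r M))
lemma2p2 k (suc r′) _ _ _ = constant k r′ , λ M 2≤M →
  let open Candidates k r′ M using (candidates; V≤L+candidates; length-candidates)
  in ℕₚ.≤-trans V≤L+candidates (ℕₚ.+-monoʳ-≤ (L k M) (length-candidates (ℕₚ.≤-trans (s≤s z≤n) 2≤M)))
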